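{- Let $G$ be a layered graph over $\Sigma_{in}$ of depth $n$, $\epsilon>0$, and $\mathsf{C}$ an $\epsilon$-sensitive $(G,\Sigma_{out})$-code. For any $w\in\Sigma_{out}^n$, it holds that $|L_i(\mathsf{C},w,\epsilon)|\le1$ for at least $(1-\epsilon)n$ values of $i\le n$.
   Context: Suffix distance: for $x,y\in\Sigma^m$, $\Delta_{sfx}(x,y)=\max_{0\le i\le m-1}\frac{\Delta(x[i+1:m],y[i+1:m])}{m-i}$ with $\Delta$ the Hamming distance. A layered graph over $\Sigma_{in}$ of depth $n$: directed graph with vertex layers $0,\dots,n$, single root in layer $0$, each vertex in layer $i<n$ having exactly $|\Sigma_{in}|$ out-edges into layer $i+1$, one per symbol of $\Sigma_{in}$ (endpoints not necessarily distinct); a string $p\in\Sigma_{in}^i$ determines a unique root path ending at vertex $v(p)$. A $(G,\Sigma_{out})$-code $\mathsf{C}$ labels each edge with an element of $\Sigma_{out}$; $\mathsf{C}(p)$ is the label string along $p$. $L_i(\mathsf{C},w,\epsilon)=\{v(p):p\in\Sigma_{in}^i,\ \Delta_{sfx}(\mathsf{C}(p),w[1:i])<1-\epsilon\}$, $L(\mathsf{C},w,\epsilon)=\bigcup_{i=1}^nL_i$. For $S\subseteq L(\mathsf{C},w,\epsilon)$, a prefix tree of $S$ is a union of paths, one from the root to each $v\in S$ satisfying $\Delta_{sfx}(\mathsf{C}(p),w[1:|p|])<1-\epsilon$, forming a rooted tree; $\mathcal{PT}(\mathsf{C},w,\epsilon)$ is the set of all prefix trees of subsets of $L(\mathsf{C},w,\epsilon)$.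 For a subgraph $H$, $w(H)$ labels each edge from layer $i-1$ to layer $i$ by $w[i]$, and $agr(\mathsf{C}(H),w(H))$ counts edges of $H$ where the two labels coincide. $\mathsf{C}$ is $\epsilon$-sensitive if for all $w\in\Sigma_{out}^n$ and all $PT\in\mathcal{PT}(\mathsf{C},w,\epsilon)$, $agr(\mathsf{C}(PT),w(PT))\le(1+\epsilon)n$.
   Formalization: The parameter ε ranges over the positive rationals. -}

module Defs where

open import Data.Nat as ℕ using (ℕ; zero; suc; z≤n; s≤s)
open import Data.Fin as Fin using (Fin; toℕ)
open import Data.Vec using (Vec; []; _∷_)
open import Data.List using (List; []; _∷_; concatMap; length; filterᵇ; deduplicate)
open import Data.List.Membership.Propositional using (_∈_)
open import Data.Maybe using (Maybe; just; nothing)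
open import Data.Bool using (Bool; false; true)
open import Data.Product using (Σ; Σ-syntax; _×_; _,_)
open import Data.Integer using (+_)
open import Data.Rational as ℚ using (ℚ; 0ℚ; 1ℚ; _/_; _⊔_; _-_)
open import Relation.Binary.PropositionalEquality using (_≡_; refl; sym; subst)
open import Relation.Binary.Definitions using (DecidableEquality)
open import Relation.Nullary using (yes; no; does)

-- Every vertex u in layer i has exactly one out-edge per symbol σ, ending at step i u σ.
-- The edge is identified with the triple (i , u , σ) (parallel edges are distinct).
-- Layers beyond n may exist in this record but are never used (all strings have length ≤ n).
record LayeredGraph (a n : ℕ) : Set where
  field
    size : ℕ → ℕ
    size-root : size 0 ≡ 1
    step : (i : ℕ) → Fin (size i) → Fin a → Fin (size (suc i))

  root : Fin (size 0)
  root = subst Fin (sym size-root) Fin.zero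

  Vtx : Set
  Vtx = Σ ℕ (λ i → Fin (size i))

  Edge : Set
  Edge = Σ ℕ (λ i → Fin (size i) × Fin a)

  head : Edge → Vtx
  head (i , u , σ) = (suc i , step i u σ)

  walk : {k : ℕ} (i : ℕ) → Fin (size i) → Vec (Fin a) k → Vtx
  walk i u [] = (i , u)
  walk i u (x ∷ xs) = walk (suc i) (step i u x) xs

  vertexOf : {k : ℕ} → Vec (Fin a) k → Vtx
  vertexOf p = walk 0 root p

  edgesFrom : {k : ℕ} (i : ℕ) → Fin (size i) → Vec (Fin a) k → List Edge
  edgesFrom i u [] = []
  edgesFrom i u (x ∷ xs) = (i , u , x) ∷ edgesFrom (suc i) (step i u x) xs

  pathEdges : {k : ℕ} → Vec (Fin a) k → List Edge
  pathEdges p = edgesFrom 0 root p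

  _≟E_ : DecidableEquality Edge
  (j , u , σ) ≟E (j' , u' , σ') with j ℕ.≟ j'
  ... | no ne = no λ { refl → ne refl }
  ... | yes refl with u Fin.≟ u' | σ Fin.≟ σ'
  ... | yes refl | yes refl = yes refl
  ... | no ne | _ = no λ { refl → ne refl }
  ... | _ | no ne = no λ { refl → ne refl }

open LayeredGraph public

Code : {a n : ℕ} → LayeredGraph a n → ℕ → Set
Code {a} G b = (i : ℕ) → Fin (size G i) → Fin a → Fin b

codeFrom : {a n b k : ℕ} (G : LayeredGraph a n) → Code G b →
           (i : ℕ) → Fin (size G i) → Vec (Fin a) k → Vec (Fin b) k
codeFrom G C i u [] = []
codeFrom G C i u (x ∷ xs) = C i u x ∷ codeFrom G C (suc i) (step G i u x) xs

codeword : {a n b k : ℕ} (G : LayeredGraph a n) → Code G b → Vec (Fin a) k → Vec (Fin b) k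
codeword G C p = codeFrom G C 0 (root G) p

hamming : {b m : ℕ} → Vec (Fin b) m → Vec (Fin b) m → ℕ
hamming [] [] = 0
hamming (x ∷ xs) (y ∷ ys) with x Fin.≟ y
... | yes _ = hamming xs ys
... | no _ = suc (hamming xs ys)

-- Suffix distance: maximum over all nonempty suffixes (of length m - i, 0 ≤ i ≤ m-1)
-- of Hamming distance / suffix length.  (Value 0 for m = 0: max over the empty set,
-- never used since all relevant strings are nonempty.)
sfxDist : {b m : ℕ} → Vec (Fin b) m → Vec (Fin b) m → ℚ
sfxDist [] [] = 0ℚ
sfxDist {m = suc m} (x ∷ xs) (y ∷ ys) =
  ((+ hamming (x ∷ xs) (y ∷ ys)) / suc m) ⊔ sfxDist xs ys

prefix : {A : Set} {i n : ℕ} → i ℕ.≤ n → Vec A n → Vec A i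
prefix z≤n _ = []
prefix (s≤s le) (x ∷ xs) = x ∷ prefix le xs

-- w[j+1] (1-based), i.e. the label w assigns to edges from layer j to layer j+1
wAt : {A : Set} {n : ℕ} → Vec A n → ℕ → Maybe A
wAt [] _ = nothing
wAt (x ∷ xs) zero = just x
wAt (x ∷ xs) (suc j) = wAt xs j

module _ {a n b : ℕ} (G : LayeredGraph a n) (C : Code G b)
         (w : Vec (Fin b) n) (ε : ℚ) where

  InL : (i : ℕ) → i ℕ.≤ n → Vtx G → Set
  InL i le v = Σ[ p ∈ Vec (Fin a) i ]
                 (sfxDist (codeword G C p) (prefix le w) ℚ.< 1ℚ - ε) × (vertexOf G p ≡ v)

  AtMostOneL : (i : ℕ) → i ℕ.≤ n → Set
  AtMostOneL i le = ∀ v v' → InL i le v → InL i le v' → v ≡ v'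

  record GoodPath : Set where
    field
      len : ℕ
      len-pos : 1 ℕ.≤ len
      len-le : len ℕ.≤ n
      str : Vec (Fin a) len
      good : sfxDist (codeword G C str) (prefix len-le w) ℚ.< 1ℚ - ε

  unionEdges : List GoodPath → List (Edge G)
  unionEdges P = concatMap (λ q → pathEdges G (GoodPath.str q)) P

  -- the union forms a rooted tree: all paths start at the root, and no vertex has
  -- two distinct incoming edges in the union
  IsTree : List GoodPath → Set
  IsTree P = ∀ e e' → e ∈ unionEdges P → e' ∈ unionEdges P → head G e ≡ head G e' → e ≡ e'

  agreesB : Edge G → Bool
  agreesB (j , u , σ) with wAt w j
  ... | nothing = false
  ... | just c = does (C j u σ Fin.≟ c)

  -- agr(C(H), w(H)) for the subgraph H = union of the paths (edges counted once)
  agr : List GoodPath → ℕ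
  agr P = length (filterᵇ agreesB (deduplicate (_≟E_ G) (unionEdges P)))

ℕtoℚ : ℕ → ℚ
ℕtoℚ k = (+ k) / 1

Sensitive : {a n b : ℕ} (G : LayeredGraph a n) → Code G b → ℚ → Set
Sensitive {a} {n} {b} G C ε =
  (w : Vec (Fin b) n) (P : List (GoodPath G C w ε)) → IsTree G C w ε P →
  ℕtoℚ (agr G C w ε P) ℚ.≤ (1ℚ ℚ.+ ε) ℚ.* ℕtoℚ n

-- Write d = 1 - ε and call a string p good when Δ_sfx(C(p), w[1:|p|]) < d. This depends only on the
-- pattern of agreements of C(p) with w, and for the pattern of p·σ it is governed by one number attached
-- to p, its slack (the least of 0 and of d·|t| - #disagreements(t) over the nonempty suffixes t):
-- p·σ is good iff slack(p) + d - δ > 0, and slack(p·σ) = min(0, slack(p) + d - δ), where δ is 1 if the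
-- last edge disagrees with w and 0 otherwise. Both are monotone in slack(p), so choosing layer by layer,
-- for every vertex, a root path of maximal slack yields paths that are good whenever the vertex lies in L,
-- and whose edges are all last edges of chosen paths. Hence the chosen paths to the vertices of L form a
-- prefix tree T. Extend the deepest of them to a root path π of
-- length n, and let w' differ from w only at the layers where no edge of T agrees with w, copying there
-- the labels of π: agreements on T survive, so T ∪ π is a prefix tree for w'. Every layer now carries an
-- agreeing edge of T ∪ π, and a layer ending in two vertices of L carries two, since a good path ends in
-- an agreement (as d ≤ 1). So agr ≥ n + #{i : |L_i| ≥ 2}, which ε-sensitivity bounds by (1 + ε)n.

module Submission where

open import Defs
open import Data.Fin using (Fin)
open import Data.Nat using (ℕ)
open import Data.Rational as ℚ using (ℚ; 0ℚ; 1ℚ; _-_)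
open import Data.Vec using (Vec)

module RationalLemmas where

  open import Data.Integer as ℤ using (+_)
  import Data.Integer.Properties as ℤ
  open import Data.Nat as ℕ using (suc)
  import Data.Nat.Properties as ℕ
  open import Data.Product using (_×_; _,_)
  open import Data.Rational as ℚ using (0ℚ; 1ℚ; _/_; _+_; _-_; _*_; _<_; _≤_; _⊓_; _⊔_)
  open import Data.Rational.Properties
  open import Data.Rational.Solver using (module +-*-Solver)
  import Data.Rational.Unnormalised as ℚᵘ
  import Data.Rational.Unnormalised.Properties as ℚᵘ
  open import Data.Sum using (inj₁; inj₂)
  open import Function using (_⇔_; mk⇔)
  open import Relation.Binary.PropositionalEquality

  toℚᵘ-ℕtoℚ : ∀ k → ℚ.toℚᵘ (ℕtoℚ k) ℚᵘ.≃ ℚᵘ.mkℚᵘ (+ k) 0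
  toℚᵘ-ℕtoℚ k = toℚᵘ-fromℚᵘ (ℚᵘ.mkℚᵘ (+ k) 0)

  ℕtoℚ-+ : ∀ x y → ℕtoℚ (x ℕ.+ y) ≡ ℕtoℚ x + ℕtoℚ y
  ℕtoℚ-+ x y = toℚᵘ-injective (begin
    ℚ.toℚᵘ (ℕtoℚ (x ℕ.+ y))                  ≈⟨ toℚᵘ-ℕtoℚ (x ℕ.+ y) ⟩
    ℚᵘ.mkℚᵘ (+ (x ℕ.+ y)) 0                   ≈⟨ ℚᵘ.*≡* (cong (ℤ._* + 1) +-hom) ⟩
    ℚᵘ.mkℚᵘ (+ x) 0 ℚᵘ.+ ℚᵘ.mkℚᵘ (+ y) 0      ≈⟨ ℚᵘ.+-cong (toℚᵘ-ℕtoℚ x) (toℚᵘ-ℕtoℚ y) ⟨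
    ℚ.toℚᵘ (ℕtoℚ x) ℚᵘ.+ ℚ.toℚᵘ (ℕtoℚ y)      ≈⟨ toℚᵘ-homo-+ (ℕtoℚ x) (ℕtoℚ y) ⟨
    ℚ.toℚᵘ (ℕtoℚ x + ℕtoℚ y)                  ∎)
    where
    open ℚᵘ.≃-Reasoning
    +-hom : + (x ℕ.+ y) ≡ + x ℤ.* + 1 ℤ.+ + y ℤ.* + 1
    +-hom = trans (ℤ.pos-+ x y) (sym (cong₂ ℤ._+_ (ℤ.*-identityʳ (+ x)) (ℤ.*-identityʳ (+ y))))

  ℕtoℚ-suc : ∀ k → ℕtoℚ (suc k) ≡ 1ℚ + ℕtoℚ k
  ℕtoℚ-suc k = ℕtoℚ-+ 1 k

  ℕtoℚ-nonNeg : ∀ k → 0ℚ ≤ ℕtoℚ k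
  ℕtoℚ-nonNeg k = nonNegative⁻¹ (ℕtoℚ k) {{normalize-nonNeg k 1}}

  ℕtoℚ-mono-≤ : ∀ {x y} → x ℕ.≤ y → ℕtoℚ x ≤ ℕtoℚ y
  ℕtoℚ-mono-≤ {x} {y} x≤y = begin
    ℕtoℚ x                       ≡⟨ +-identityʳ (ℕtoℚ x) ⟨
    ℕtoℚ x + 0ℚ                  ≤⟨ +-monoʳ-≤ (ℕtoℚ x) (ℕtoℚ-nonNeg (y ℕ.∸ x)) ⟩
    ℕtoℚ x + ℕtoℚ (y ℕ.∸ x)      ≡⟨ ℕtoℚ-+ x (y ℕ.∸ x) ⟨
    ℕtoℚ (x ℕ.+ (y ℕ.∸ x))       ≡⟨ cong ℕtoℚ (ℕ.m+[n∸m]≡n x≤y) ⟩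
    ℕtoℚ y                       ∎
    where open ≤-Reasoning

  ℕtoℚ-suc-pos : ∀ l → ℚ.Positive (ℕtoℚ (suc l))
  ℕtoℚ-suc-pos l = normalize-pos (suc l) 1

  /suc*ℕtoℚ-suc : ∀ h l → (+ h / suc l) * ℕtoℚ (suc l) ≡ ℕtoℚ h
  /suc*ℕtoℚ-suc h l = toℚᵘ-injective (begin
    ℚ.toℚᵘ ((+ h / suc l) * ℕtoℚ (suc l))           ≈⟨ toℚᵘ-homo-* (+ h / suc l) (ℕtoℚ (suc l)) ⟩
    ℚ.toℚᵘ (+ h / suc l) ℚᵘ.* ℚ.toℚᵘ (ℕtoℚ (suc l))
      ≈⟨ ℚᵘ.*-cong (toℚᵘ-fromℚᵘ (ℚᵘ.mkℚᵘ (+ h) l)) (toℚᵘ-ℕtoℚ (suc l)) ⟩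
    ℚᵘ.mkℚᵘ (+ h) l ℚᵘ.* ℚᵘ.mkℚᵘ (+ suc l) 0        ≈⟨ ℚᵘ.*≡* cancel ⟩
    ℚᵘ.mkℚᵘ (+ h) 0                                 ≈⟨ toℚᵘ-ℕtoℚ h ⟨
    ℚ.toℚᵘ (ℕtoℚ h)                                 ∎)
    where
    open ℚᵘ.≃-Reasoning
    cancel : + h ℤ.* + suc l ℤ.* + 1 ≡ + h ℤ.* + suc (l ℕ.* 1)
    cancel = trans (ℤ.*-identityʳ _) (cong (λ m → + h ℤ.* + suc m) (sym (ℕ.*-identityʳ l)))

  /suc<⇔<*ℕtoℚ-suc : ∀ h l d → (+ h / suc l) < d ⇔ ℕtoℚ h < d * ℕtoℚ (suc l)
  /suc<⇔<*ℕtoℚ-suc h l d = mk⇔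
    (λ lt → subst (_< d * ℕtoℚ (suc l)) (/suc*ℕtoℚ-suc h l)
              (*-monoˡ-<-pos (ℕtoℚ (suc l)) {{ℕtoℚ-suc-pos l}} lt))
    (λ lt → *-cancelʳ-<-nonNeg (ℕtoℚ (suc l)) {{pos⇒nonNeg (ℕtoℚ (suc l)) {{ℕtoℚ-suc-pos l}}}}
              (subst (_< d * ℕtoℚ (suc l)) (sym (/suc*ℕtoℚ-suc h l)) lt))

  *ℕtoℚ-≤-ℕtoℚ : ∀ {d} k → d ≤ 1ℚ → d * ℕtoℚ k ≤ ℕtoℚ k
  *ℕtoℚ-≤-ℕtoℚ {d} k d≤1 = subst (d * ℕtoℚ k ≤_) (*-identityˡ (ℕtoℚ k))
    (*-monoʳ-≤-nonNeg (ℕtoℚ k) {{ℚ.nonNegative (ℕtoℚ-nonNeg k)}} d≤1)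

  *ℕtoℚ-≤-0 : ∀ {d} k → d ≤ 0ℚ → d * ℕtoℚ k ≤ 0ℚ
  *ℕtoℚ-≤-0 {d} k d≤0 = subst (d * ℕtoℚ k ≤_) (*-zeroˡ (ℕtoℚ k))
    (*-monoʳ-≤-nonNeg (ℕtoℚ k) {{ℚ.nonNegative (ℕtoℚ-nonNeg k)}} d≤0)

  counting-bound : ∀ s l N ε → s ℕ.+ l ≡ N ℕ.+ N → ℕtoℚ l ≤ (1ℚ + ε) * ℕtoℚ N →
                   (1ℚ - ε) * ℕtoℚ N ≤ ℕtoℚ s
  counting-bound s l N ε s+l≡N+N l≤[1+ε]N = begin
    (1ℚ - ε) * ℕtoℚ N
      ≡⟨ solve 2 (λ N ε → (con 1ℚ :- ε) :* N := (N :+ N) :- (con 1ℚ :+ ε) :* N) refl (ℕtoℚ N) ε ⟩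
    (ℕtoℚ N + ℕtoℚ N) - (1ℚ + ε) * ℕtoℚ N
      ≤⟨ +-monoʳ-≤ (ℕtoℚ N + ℕtoℚ N) (neg-antimono-≤ l≤[1+ε]N) ⟩
    (ℕtoℚ N + ℕtoℚ N) - ℕtoℚ l
      ≡⟨ cong (_- ℕtoℚ l) N+N≡s+l ⟩
    (ℕtoℚ s + ℕtoℚ l) - ℕtoℚ l
      ≡⟨ solve 2 (λ s l → (s :+ l) :- l := s) refl (ℕtoℚ s) (ℕtoℚ l) ⟩
    ℕtoℚ s ∎
    where
    open ≤-Reasoning
    open +-*-Solver
    N+N≡s+l : ℕtoℚ N + ℕtoℚ N ≡ ℕtoℚ s + ℕtoℚ l
    N+N≡s+l = trans (sym (ℕtoℚ-+ N N)) (trans (cong ℕtoℚ (sym s+l≡N+N)) (ℕtoℚ-+ s l))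

  p<q⇔0<q-p : ∀ p q → p < q ⇔ 0ℚ < q - p
  p<q⇔0<q-p p q = mk⇔
    (λ p<q → subst (_< q - p) (+-inverseʳ p) (+-monoˡ-< (ℚ.- p) p<q))
    (λ 0<q-p → subst₂ _<_ (+-identityˡ p) (q-p+p≡q) (+-monoˡ-< p 0<q-p))
    where
    q-p+p≡q : q - p + p ≡ q
    q-p+p≡q = solve 2 (λ q p → (q :- p) :+ p := q) refl q p
      where open +-*-Solver

  p<q⊓r⇔p<q×p<r : ∀ p q r → p < q ⊓ r ⇔ (p < q × p < r)
  p<q⊓r⇔p<q×p<r p q r = mk⇔
    (λ p<q⊓r → <-≤-trans p<q⊓r (p⊓q≤p q r) , <-≤-trans p<q⊓r (p⊓q≤q q r))
    glb
    where
    glb : p < q × p < r → p < q ⊓ r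
    glb (p<q , p<r) with ⊓-sel q r
    ... | inj₁ q⊓r≡q = subst (p <_) (sym q⊓r≡q) p<q
    ... | inj₂ q⊓r≡r = subst (p <_) (sym q⊓r≡r) p<r

  p⊔q<r⇔p<r×q<r : ∀ p q r → p ⊔ q < r ⇔ (p < r × q < r)
  p⊔q<r⇔p<r×q<r p q r = mk⇔
    (λ p⊔q<r → ≤-<-trans (p≤p⊔q p q) p⊔q<r , ≤-<-trans (p≤q⊔p p q) p⊔q<r)
    lub
    where
    lub : p < r × q < r → p ⊔ q < r
    lub (p<r , q<r) with ⊔-sel p q
    ... | inj₁ p⊔q≡p = subst (_< r) (sym p⊔q≡p) p<r
    ... | inj₂ p⊔q≡q = subst (_< r) (sym p⊔q≡q) q<r

  ⊓-distribʳ-+ : ∀ p q r → (p ⊓ q) + r ≡ (p + r) ⊓ (q + r)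
  ⊓-distribʳ-+ p q r = mono-≤-distrib-⊓ (+-monoˡ-≤ r) p q

module AgreementStrings where

  open import Data.Bool as Bool using (Bool; true; false; f≤t; b≤b)
  open import Data.Empty using (⊥-elim)
  open import Data.Integer using (+_)
  open import Data.Nat as ℕ using (ℕ; suc)
  import Data.Nat.Properties as ℕ
  open import Data.Product using (_×_; _,_)
  open import Data.Rational as ℚ using (ℚ; 0ℚ; 1ℚ; _/_; _+_; _-_; _*_; _<_; _≤_; _⊓_; _⊔_)
  open import Data.Rational.Properties
  open import Data.Rational.Solver using (module +-*-Solver)
  open import Data.Unit using (⊤; tt)
  open import Data.Vec as Vec using (Vec; []; _∷_; _∷ʳ_; _++_)
  open import Data.Vec.Properties using (init-∷ʳ; last-∷ʳ)
  open import Data.Vec.Relation.Binary.Pointwise.Inductive using (Pointwise; []; _∷_)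
  open import Data.Product.Function.NonDependent.Propositional using (_×-⇔_)
  open import Function using (_⇔_; mk⇔; Equivalence)
  open import Function.Properties.Equivalence using () renaming (trans to ⇔-trans)
  open import Relation.Binary.PropositionalEquality
  open RationalLemmas

  private
    variable
      k t : ℕ

  implies⇒≤ : ∀ {β β'} → (β ≡ true → β' ≡ true) → β Bool.≤ β'
  implies⇒≤ {false} {false} _ = b≤b
  implies⇒≤ {false} {true} _ = f≤t
  implies⇒≤ {true} β⇒β' rewrite β⇒β' refl = b≤b

  disagree : Bool → ℕ
  disagree true = 0
  disagree false = 1

  disagreements : Vec Bool k → ℕ
  disagreements [] = 0
  disagreements (β ∷ bs) = disagree β ℕ.+ disagreements bs

  disagreements-∷ʳ : ∀ (bs : Vec Bool k) β → disagreements (bs ∷ʳ β) ≡ disagreements bs ℕ.+ disagree β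
  disagreements-∷ʳ [] β = ℕ.+-comm (disagree β) 0
  disagreements-∷ʳ (x ∷ bs) β =
    trans (cong (disagree x ℕ.+_) (disagreements-∷ʳ bs β)) (sym (ℕ.+-assoc (disagree x) _ _))

  disagreements-++ : ∀ (bs : Vec Bool k) (ts : Vec Bool t) →
                     disagreements (bs ++ ts) ≡ disagreements bs ℕ.+ disagreements ts
  disagreements-++ [] ts = refl
  disagreements-++ (x ∷ bs) ts =
    trans (cong (disagree x ℕ.+_) (disagreements-++ bs ts)) (sym (ℕ.+-assoc (disagree x) _ _))

  disagree-antitone : ∀ {β β'} → β Bool.≤ β' → disagree β' ℕ.≤ disagree β
  disagree-antitone f≤t = ℕ.z≤n
  disagree-antitone b≤b = ℕ.≤-refl

  disagreements-antitone : ∀ {bs bs' : Vec Bool k} → Pointwise Bool._≤_ bs bs' →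
                           disagreements bs' ℕ.≤ disagreements bs
  disagreements-antitone [] = ℕ.z≤n
  disagreements-antitone (β≤β' ∷ bs≤bs') = ℕ.+-mono-≤ (disagree-antitone β≤β') (disagreements-antitone bs≤bs')

  sfxDistᵇ : Vec Bool k → ℚ
  sfxDistᵇ [] = 0ℚ
  sfxDistᵇ {suc k} (β ∷ bs) = (+ disagreements (β ∷ bs) / suc k) ⊔ sfxDistᵇ bs

  module Slack (d : ℚ) where

    gain : Bool → ℚ
    gain β = d - ℕtoℚ (disagree β)

    suffixSlack : Vec Bool k → ℚ
    suffixSlack {k} bs = d * ℕtoℚ k - ℕtoℚ (disagreements bs)

    SuffixGood : Vec Bool k → Set
    SuffixGood [] = ⊤
    SuffixGood (β ∷ bs) = 0ℚ < suffixSlack (β ∷ bs) × SuffixGood bs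

    slack : Vec Bool k → ℚ
    slack [] = 0ℚ
    slack (β ∷ bs) = suffixSlack (β ∷ bs) ⊓ slack bs

    suffixSlack-[] : suffixSlack [] ≡ 0ℚ
    suffixSlack-[] = cong (_- 0ℚ) (*-zeroʳ d)

    suffixSlack-∷ʳ : ∀ (bs : Vec Bool k) β → suffixSlack (bs ∷ʳ β) ≡ suffixSlack bs + gain β
    suffixSlack-∷ʳ {k} bs β = begin
      d * ℕtoℚ (suc k) - ℕtoℚ (disagreements (bs ∷ʳ β))
        ≡⟨ cong₂ (λ K H → d * K - H) (ℕtoℚ-suc k)
                 (trans (cong ℕtoℚ (disagreements-∷ʳ bs β)) (ℕtoℚ-+ (disagreements bs) (disagree β))) ⟩
      d * (1ℚ + ℕtoℚ k) - (ℕtoℚ (disagreements bs) + ℕtoℚ (disagree β))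
        ≡⟨ solve 4 (λ d K H h → d :* (con 1ℚ :+ K) :- (H :+ h) := (d :* K :- H) :+ (d :- h))
                 refl d (ℕtoℚ k) (ℕtoℚ (disagreements bs)) (ℕtoℚ (disagree β)) ⟩
      suffixSlack bs + gain β ∎
      where
      open ≡-Reasoning
      open +-*-Solver

    suffixSlack-antitone : ∀ {bs bs' : Vec Bool k} → disagreements bs' ℕ.≤ disagreements bs →
                           suffixSlack bs ℚ.≤ suffixSlack bs'
    suffixSlack-antitone {k} le = +-monoʳ-≤ (d * ℕtoℚ k) (neg-antimono-≤ (ℕtoℚ-mono-≤ le))

    slack≤0 : ∀ (bs : Vec Bool k) → slack bs ℚ.≤ 0ℚ
    slack≤0 [] = ≤-refl
    slack≤0 (β ∷ bs) = ≤-trans (p⊓q≤q (suffixSlack (β ∷ bs)) (slack bs)) (slack≤0 bs)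

    SuffixGood-∷ʳ⁺ : ∀ (bs : Vec Bool k) β → SuffixGood (bs ∷ʳ β) → 0ℚ < slack bs + gain β
    SuffixGood-∷ʳ⁺ [] β (0<s , _) =
      subst (0ℚ <_) (trans (suffixSlack-∷ʳ [] β) (cong (_+ gain β) suffixSlack-[])) 0<s
    SuffixGood-∷ʳ⁺ (x ∷ bs) β (0<s , good) =
      subst (0ℚ <_) (sym (⊓-distribʳ-+ (suffixSlack (x ∷ bs)) (slack bs) (gain β)))
        (Equivalence.from (p<q⊓r⇔p<q×p<r _ _ _)
          (subst (0ℚ <_) (suffixSlack-∷ʳ (x ∷ bs) β) 0<s , SuffixGood-∷ʳ⁺ bs β good))

    SuffixGood-∷ʳ⁻ : ∀ (bs : Vec Bool k) β → 0ℚ < slack bs + gain β → SuffixGood (bs ∷ʳ β)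
    SuffixGood-∷ʳ⁻ [] β 0<g =
      subst (0ℚ <_) (sym (trans (suffixSlack-∷ʳ [] β) (cong (_+ gain β) suffixSlack-[]))) 0<g , tt
    SuffixGood-∷ʳ⁻ (x ∷ bs) β 0<s+g with Equivalence.to (p<q⊓r⇔p<q×p<r _ _ _)
      (subst (0ℚ <_) (⊓-distribʳ-+ (suffixSlack (x ∷ bs)) (slack bs) (gain β)) 0<s+g)
    ... | 0<x , 0<rest = subst (0ℚ <_) (sym (suffixSlack-∷ʳ (x ∷ bs) β)) 0<x , SuffixGood-∷ʳ⁻ bs β 0<rest

    slack-∷ʳ : ∀ (bs : Vec Bool k) β → slack (bs ∷ʳ β) ≡ 0ℚ ⊓ (slack bs + gain β)
    slack-∷ʳ [] β = trans (⊓-comm (suffixSlack ([] ∷ʳ β)) 0ℚ)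
                          (cong (0ℚ ⊓_) (trans (suffixSlack-∷ʳ [] β) (cong (_+ gain β) suffixSlack-[])))
    slack-∷ʳ (x ∷ bs) β = begin
      suffixSlack (x ∷ (bs ∷ʳ β)) ⊓ slack (bs ∷ʳ β)
        ≡⟨ cong₂ _⊓_ (suffixSlack-∷ʳ (x ∷ bs) β) (slack-∷ʳ bs β) ⟩
      (s + g) ⊓ (0ℚ ⊓ (slack bs + g))              ≡⟨ ⊓-assoc (s + g) 0ℚ _ ⟨
      ((s + g) ⊓ 0ℚ) ⊓ (slack bs + g)              ≡⟨ cong (_⊓ (slack bs + g)) (⊓-comm (s + g) 0ℚ) ⟩
      (0ℚ ⊓ (s + g)) ⊓ (slack bs + g)              ≡⟨ ⊓-assoc 0ℚ (s + g) _ ⟩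
      0ℚ ⊓ ((s + g) ⊓ (slack bs + g))              ≡⟨ cong (0ℚ ⊓_) (⊓-distribʳ-+ s (slack bs) g) ⟨
      0ℚ ⊓ ((s ⊓ slack bs) + g)                    ∎
      where
      open ≡-Reasoning
      s g : ℚ
      s = suffixSlack (x ∷ bs)
      g = gain β

    potential : Vec Bool (suc k) → ℚ
    potential bs = slack (Vec.init bs) + gain (Vec.last bs)

    potential-∷ʳ : ∀ (bs : Vec Bool k) β → potential (bs ∷ʳ β) ≡ slack bs + gain β
    potential-∷ʳ bs β = cong₂ (λ xs x → slack xs + gain x) (init-∷ʳ β bs) (last-∷ʳ β bs)

    slack≡0⊓potential : ∀ (bs : Vec Bool (suc k)) → slack bs ≡ 0ℚ ⊓ potential bs
    slack≡0⊓potential bs =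
      let bs₀ , β , bs≡ = Vec.initLast bs in
      subst (λ xs → slack xs ≡ 0ℚ ⊓ potential xs) (sym bs≡)
        (trans (slack-∷ʳ bs₀ β) (cong (0ℚ ⊓_) (sym (potential-∷ʳ bs₀ β))))

    SuffixGood⇔0<potential : ∀ (bs : Vec Bool (suc k)) → SuffixGood bs ⇔ 0ℚ < potential bs
    SuffixGood⇔0<potential bs =
      let bs₀ , β , bs≡ = Vec.initLast bs in
      subst (λ xs → SuffixGood xs ⇔ 0ℚ < potential xs) (sym bs≡) (mk⇔
        (λ good → subst (0ℚ <_) (sym (potential-∷ʳ bs₀ β)) (SuffixGood-∷ʳ⁺ bs₀ β good))
        (λ 0<p → SuffixGood-∷ʳ⁻ bs₀ β (subst (0ℚ <_) (potential-∷ʳ bs₀ β) 0<p)))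

    SuffixGood-antitone : ∀ {bs bs' : Vec Bool k} → Pointwise Bool._≤_ bs bs' → SuffixGood bs → SuffixGood bs'
    SuffixGood-antitone [] tt = tt
    SuffixGood-antitone {bs = β ∷ bs} {β' ∷ bs'} (β≤β' ∷ bs≤bs') (0<s , good) =
      <-≤-trans 0<s (suffixSlack-antitone {bs = β ∷ bs} {β' ∷ bs'} (disagreements-antitone (β≤β' ∷ bs≤bs'))) ,
      SuffixGood-antitone bs≤bs' good

    module _ (0<d : 0ℚ < d) where

      sfxDistᵇ<d⇔SuffixGood : ∀ (bs : Vec Bool k) → sfxDistᵇ bs < d ⇔ SuffixGood bs
      sfxDistᵇ<d⇔SuffixGood [] = mk⇔ (λ _ → tt) (λ _ → 0<d)
      sfxDistᵇ<d⇔SuffixGood {suc k} (β ∷ bs) =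
        ⇔-trans (p⊔q<r⇔p<r×q<r _ _ d)
          (⇔-trans (/suc<⇔<*ℕtoℚ-suc H k d) (p<q⇔0<q-p (ℕtoℚ H) (d * ℕtoℚ (suc k)))
            ×-⇔ sfxDistᵇ<d⇔SuffixGood bs)
        where
        H : ℕ
        H = disagreements (β ∷ bs)

      SuffixGood-agreeing : ∀ (ts : Vec Bool t) → disagreements ts ≡ 0 → SuffixGood ts
      SuffixGood-agreeing [] _ = tt
      SuffixGood-agreeing {suc t} (true ∷ ts) ts-agree =
        subst (λ H → 0ℚ < d * ℕtoℚ (suc t) - ℕtoℚ H) (sym ts-agree)
          (subst (0ℚ <_) (sym (+-identityʳ (d * ℕtoℚ (suc t))))
            (subst (_< d * ℕtoℚ (suc t)) (*-zeroˡ (ℕtoℚ (suc t)))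
              (*-monoˡ-<-pos (ℕtoℚ (suc t)) {{ℕtoℚ-suc-pos t}} 0<d))) ,
        SuffixGood-agreeing ts ts-agree

      SuffixGood-++-agreeing : ∀ (bs : Vec Bool k) (ts : Vec Bool t) → disagreements ts ≡ 0 →
                               SuffixGood bs → SuffixGood (bs ++ ts)
      SuffixGood-++-agreeing [] ts ts-agree _ = SuffixGood-agreeing ts ts-agree
      SuffixGood-++-agreeing {suc k} {t} (x ∷ bs) ts ts-agree (0<s , good) =
        <-≤-trans 0<s longer , SuffixGood-++-agreeing bs ts ts-agree good
        where
        longer : suffixSlack (x ∷ bs) ℚ.≤ suffixSlack (x ∷ bs ++ ts)
        longer = subst (λ H → d * ℕtoℚ (suc k) - ℕtoℚ (disagreements (x ∷ bs))
                                ℚ.≤ d * ℕtoℚ (suc k ℕ.+ t) - ℕtoℚ H)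
                   (sym (trans (disagreements-++ (x ∷ bs) ts) (trans (cong (_ ℕ.+_) ts-agree) (ℕ.+-identityʳ _))))
                   (+-monoˡ-≤ (ℚ.- ℕtoℚ (disagreements (x ∷ bs)))
                     (*-monoˡ-≤-nonNeg d {{ℚ.nonNegative (<⇒≤ 0<d)}} (ℕtoℚ-mono-≤ (ℕ.m≤m+n (suc k) t))))

    SuffixGood-∷ʳ⇒agree : d ℚ.≤ 1ℚ → ∀ (bs : Vec Bool k) β → SuffixGood (bs ∷ʳ β) → β ≡ true
    SuffixGood-∷ʳ⇒agree d≤1 bs true _ = refl
    SuffixGood-∷ʳ⇒agree d≤1 bs false good =
      ⊥-elim (<-irrefl refl (<-≤-trans (SuffixGood-∷ʳ⁺ bs false good) slack+gain≤0))
      where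
      slack+gain≤0 : slack bs + (d - 1ℚ) ℚ.≤ 0ℚ
      slack+gain≤0 = begin
        slack bs + (d - 1ℚ)   ≤⟨ +-monoˡ-≤ (d - 1ℚ) (slack≤0 bs) ⟩
        0ℚ + (d - 1ℚ)         ≡⟨ +-identityˡ (d - 1ℚ) ⟩
        d - 1ℚ                ≤⟨ +-monoˡ-≤ (ℚ.- 1ℚ) d≤1 ⟩
        1ℚ - 1ℚ               ≡⟨ +-inverseʳ 1ℚ ⟩
        0ℚ                    ∎
        where open ≤-Reasoning

module LayeredPaths {a n : ℕ} (G : LayeredGraph a n) where

  open import Data.Empty using (⊥-elim)
  open import Data.Fin as Fin using (Fin)
  open import Data.List as List using ([]; _∷_; [_])
  open import Data.List.Membership.Propositional using (_∈_)
  open import Data.List.Relation.Unary.Any using (Any; here; there)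
  open import Data.Nat as ℕ using (ℕ; zero; suc; z≤n; s≤s; _≤_; _<_)
  import Data.Nat.Properties as ℕ
  open import Data.Product using (∃-syntax; _×_; _,_; proj₁)
  open import Data.Product.Properties using (,-injectiveʳ-UIP)
  open import Data.Vec as Vec using (Vec; []; _∷_; _∷ʳ_; _++_)
  open import Relation.Nullary using (yes; no)
  open import Relation.Binary.PropositionalEquality hiding ([_])

  private
    variable
      k t : ℕ

  layer0-singleton : (u v : Fin (size G 0)) → u ≡ v
  layer0-singleton = subst (λ m → (u v : Fin m) → u ≡ v) (sym (size-root G)) λ { Fin.zero Fin.zero → refl }

  walk-∷ʳ : ∀ i u (q : Vec (Fin a) k) σ {j x} → walk G i u q ≡ (j , x) →
            walk G i u (q ∷ʳ σ) ≡ (suc j , step G j x σ)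
  walk-∷ʳ i u [] σ refl = refl
  walk-∷ʳ i u (y ∷ q) σ end = walk-∷ʳ (suc i) (step G i u y) q σ end

  walk-layer : ∀ i u (q : Vec (Fin a) k) → ∃[ x ] walk G i u q ≡ (i ℕ.+ k , x)
  walk-layer {zero} i u [] rewrite ℕ.+-identityʳ i = u , refl
  walk-layer {suc k} i u (y ∷ q) rewrite ℕ.+-suc i k = walk-layer (suc i) (step G i u y) q

  edgesFrom-∷ʳ : ∀ i u (q : Vec (Fin a) k) σ {j x} → walk G i u q ≡ (j , x) →
                 edgesFrom G i u (q ∷ʳ σ) ≡ edgesFrom G i u q List.++ [ (j , x , σ) ]
  edgesFrom-∷ʳ i u [] σ refl = refl
  edgesFrom-∷ʳ i u (y ∷ q) σ end = cong (_ ∷_) (edgesFrom-∷ʳ (suc i) (step G i u y) q σ end)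

  edgesFrom-++ : ∀ i u (q : Vec (Fin a) k) (r : Vec (Fin a) t) {j x} → walk G i u q ≡ (j , x) →
                 edgesFrom G i u (q ++ r) ≡ edgesFrom G i u q List.++ edgesFrom G j x r
  edgesFrom-++ i u [] r refl = refl
  edgesFrom-++ i u (y ∷ q) r end = cong (_ ∷_) (edgesFrom-++ (suc i) (step G i u y) q r end)

  ∈edgesFrom⇒layer : ∀ i u (q : Vec (Fin a) k) {e} → e ∈ edgesFrom G i u q →
                     i ≤ proj₁ e × proj₁ e < i ℕ.+ k
  ∈edgesFrom⇒layer {suc k} i u (y ∷ q) (here refl) = ℕ.≤-refl , ℕ.m<m+n i (s≤s z≤n)
  ∈edgesFrom⇒layer {suc k} i u (y ∷ q) {e} (there e∈) with ∈edgesFrom⇒layer (suc i) (step G i u y) q e∈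
  ... | i<j , j<i+1+k = ℕ.<⇒≤ i<j , subst (proj₁ e <_) (sym (ℕ.+-suc i k)) j<i+1+k

  edgesFrom-layer-injective : ∀ i u (q : Vec (Fin a) k) {e e'} →
    e ∈ edgesFrom G i u q → e' ∈ edgesFrom G i u q → proj₁ e ≡ proj₁ e' → e ≡ e'
  edgesFrom-layer-injective i u (y ∷ q) (here refl) (here refl) _ = refl
  edgesFrom-layer-injective i u (y ∷ q) (here refl) (there e'∈) i≡j =
    ⊥-elim (ℕ.<-irrefl i≡j (proj₁ (∈edgesFrom⇒layer (suc i) (step G i u y) q e'∈)))
  edgesFrom-layer-injective i u (y ∷ q) (there e∈) (here refl) j≡i =
    ⊥-elim (ℕ.<-irrefl (sym j≡i) (proj₁ (∈edgesFrom⇒layer (suc i) (step G i u y) q e∈)))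
  edgesFrom-layer-injective i u (y ∷ q) (there e∈) (there e'∈) =
    edgesFrom-layer-injective (suc i) (step G i u y) q e∈ e'∈

  edgesFrom-layer-surjective : ∀ i u (q : Vec (Fin a) k) j → i ≤ j → j < i ℕ.+ k →
                               Any (λ e → proj₁ e ≡ j) (edgesFrom G i u q)
  edgesFrom-layer-surjective {zero} i u [] j i≤j j<i+0 =
    ⊥-elim (ℕ.<-irrefl refl (ℕ.≤-<-trans i≤j (subst (j <_) (ℕ.+-identityʳ i) j<i+0)))
  edgesFrom-layer-surjective {suc k} i u (y ∷ q) j i≤j j<i+1+k with i ℕ.≟ j
  ... | yes refl = here refl
  ... | no i≢j = there (edgesFrom-layer-surjective (suc i) (step G i u y) q j (ℕ.≤∧≢⇒< i≤j i≢j)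
                          (subst (j <_) (ℕ.+-suc i k) j<i+1+k))

  vertexOf-∷ʳ⁻ : ∀ (q : Vec (Fin a) (suc k)) {y} → vertexOf G q ≡ (suc k , y) →
    ∃[ q₀ ] ∃[ σ ] ∃[ x ] q ≡ q₀ ∷ʳ σ × vertexOf G q₀ ≡ (k , x) × step G k x σ ≡ y
  vertexOf-∷ʳ⁻ q end with Vec.initLast q
  ... | q₀ , σ , refl with walk-layer 0 (root G) q₀
  ...   | x , end₀ =
    q₀ , σ , x , refl , end₀ , ,-injectiveʳ-UIP ℕ.≡-irrelevant (trans (sym (walk-∷ʳ 0 (root G) q₀ σ end₀)) end)

module CodeAgreement {a n b : ℕ} (G : LayeredGraph a n) (C : Code G b) (ε : ℚ) where

  open import Data.Bool using (Bool; true)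
  open import Data.Empty using (⊥-elim)
  open import Data.Fin as Fin using (Fin)
  open import Data.Integer using (+_)
  open import Data.List.Membership.Propositional using (_∈_)
  open import Data.List.Relation.Unary.Any using (here; there)
  open import Data.Maybe using (just; nothing)
  open import Data.Nat as ℕ using (ℕ; suc; z≤n; s≤s; _≤_)
  open import Data.Product using (_×_; _,_)
  open import Data.Rational as ℚ using (ℚ)
  open import Data.Unit using (⊤; tt)
  open import Data.Vec using (Vec; []; _∷_; _∷ʳ_; _++_)
  open import Function using (_⇔_; mk⇔)
  open import Relation.Nullary using (yes; no)
  open import Relation.Binary.PropositionalEquality
  open AgreementStrings

  private
    variable
      k t : ℕ

  agrees : Vec (Fin b) n → Edge G → Bool
  agrees w = agreesB G C w ε

  agrees≡true⇔ : ∀ w j u σ → agrees w (j , u , σ) ≡ true ⇔ wAt w j ≡ just (C j u σ)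
  agrees≡true⇔ w j u σ = mk⇔ to from
    where
    to : agrees w (j , u , σ) ≡ true → wAt w j ≡ just (C j u σ)
    to agree with wAt w j
    to ()    | nothing
    to agree | just c with C j u σ Fin.≟ c
    to _     | just c | yes refl = refl
    to ()    | just c | no _
    from : wAt w j ≡ just (C j u σ) → agrees w (j , u , σ) ≡ true
    from w[j] with wAt w j | w[j]
    ... | just .(C j u σ) | refl with C j u σ Fin.≟ C j u σ
    ...   | yes _ = refl
    ...   | no ≢ = ⊥-elim (≢ refl)

  agreementsFrom : Vec (Fin b) n → ∀ i → Fin (size G i) → Vec (Fin a) k → Vec Bool k
  agreementsFrom w i u [] = []
  agreementsFrom w i u (x ∷ xs) = agrees w (i , u , x) ∷ agreementsFrom w (suc i) (step G i u x) xs

  agreements : Vec (Fin b) n → Vec (Fin a) k → Vec Bool k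
  agreements w q = agreementsFrom w 0 (root G) q

  agreementsFrom-∷ʳ : ∀ w i u (q : Vec (Fin a) k) σ {j x} → walk G i u q ≡ (j , x) →
    agreementsFrom w i u (q ∷ʳ σ) ≡ agreementsFrom w i u q ∷ʳ agrees w (j , x , σ)
  agreementsFrom-∷ʳ w i u [] σ refl = refl
  agreementsFrom-∷ʳ w i u (y ∷ q) σ end = cong (_ ∷_) (agreementsFrom-∷ʳ w (suc i) (step G i u y) q σ end)

  agreementsFrom-++ : ∀ w i u (q : Vec (Fin a) k) (r : Vec (Fin a) t) {j x} → walk G i u q ≡ (j , x) →
    agreementsFrom w i u (q ++ r) ≡ agreementsFrom w i u q ++ agreementsFrom w j x r
  agreementsFrom-++ w i u [] r refl = refl
  agreementsFrom-++ w i u (y ∷ q) r end = cong (_ ∷_) (agreementsFrom-++ w (suc i) (step G i u y) q r end)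

  agreementsFrom-all-agree : ∀ w i u (q : Vec (Fin a) k) → (∀ {e} → e ∈ edgesFrom G i u q → agrees w e ≡ true) →
                             disagreements (agreementsFrom w i u q) ≡ 0
  agreementsFrom-all-agree w i u [] _ = refl
  agreementsFrom-all-agree w i u (x ∷ q) all-agree rewrite all-agree (here refl) =
    agreementsFrom-all-agree w (suc i) (step G i u x) q (λ e∈ → all-agree (there e∈))

  WindowAt : ∀ {A : Set} {m} → Vec A m → ℕ → Vec A k → Set
  WindowAt w i [] = ⊤
  WindowAt w i (y ∷ ys) = wAt w i ≡ just y × WindowAt w (suc i) ys

  WindowAt-∷ : ∀ {A : Set} {m} (x : A) (w : Vec A m) i (ys : Vec A k) →
               WindowAt w i ys → WindowAt (x ∷ w) (suc i) ys
  WindowAt-∷ x w i [] tt = tt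
  WindowAt-∷ x w i (y ∷ ys) (w[i] , rest) = w[i] , WindowAt-∷ x w (suc i) ys rest

  WindowAt-prefix : ∀ {A : Set} {m} (le : k ≤ m) (w : Vec A m) → WindowAt w 0 (prefix le w)
  WindowAt-prefix z≤n w = tt
  WindowAt-prefix (s≤s le) (x ∷ w) = refl , WindowAt-∷ x w 0 (prefix le w) (WindowAt-prefix le w)

  hamming-codeFrom : ∀ w i u (q : Vec (Fin a) k) ys → WindowAt w i ys →
                     hamming (codeFrom G C i u q) ys ≡ disagreements (agreementsFrom w i u q)
  hamming-codeFrom w i u [] [] tt = refl
  hamming-codeFrom w i u (x ∷ q) (y ∷ ys) (w[i] , rest) with wAt w i | w[i]
  ... | just .y | refl with C i u x Fin.≟ y
  ...   | yes _ = hamming-codeFrom w (suc i) (step G i u x) q ys rest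
  ...   | no _ = cong suc (hamming-codeFrom w (suc i) (step G i u x) q ys rest)

  sfxDist-codeFrom : ∀ w i u (q : Vec (Fin a) k) ys → WindowAt w i ys →
                     sfxDist (codeFrom G C i u q) ys ≡ sfxDistᵇ (agreementsFrom w i u q)
  sfxDist-codeFrom w i u [] [] tt = refl
  sfxDist-codeFrom {suc k} w i u (x ∷ q) (y ∷ ys) window@(_ , rest) =
    cong₂ ℚ._⊔_ (cong (λ h → + h ℚ./ suc k) (hamming-codeFrom w i u (x ∷ q) (y ∷ ys) window))
                (sfxDist-codeFrom w (suc i) (step G i u x) q ys rest)

  sfxDist-codeword : ∀ w (le : k ≤ n) (q : Vec (Fin a) k) →
                     sfxDist (codeword G C q) (prefix le w) ≡ sfxDistᵇ (agreements w q)
  sfxDist-codeword w le q = sfxDist-codeFrom w 0 (root G) q (prefix le w) (WindowAt-prefix le w)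

module MaybeArgmax {A : Set} (f : A → ℚ) where

  open import Data.List using (List; []; _∷_)
  open import Data.List.Membership.Propositional using (_∈_)
  import Data.List.Relation.Unary.All as All
  open import Data.List.Relation.Unary.Any using (here; there)
  open import Data.Maybe using (Maybe; just; nothing)
  open import Data.Product using (∃-syntax; _×_; _,_)
  open import Data.Rational using (ℚ; _≤_)
  open import Data.Rational.Properties using (≤-decTotalOrder)
  open import Data.Sum using (inj₁; inj₂)
  open import Relation.Binary.Bundles using (DecTotalOrder)
  open import Relation.Binary.PropositionalEquality

  open import Data.List.Extrema (DecTotalOrder.totalOrder ≤-decTotalOrder)
    using (argmax; argmax-sel; f[⊥]≤f[argmax]; f[xs]≤f[argmax])

  argmaxᴹ : List A → Maybe A
  argmaxᴹ [] = nothing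
  argmaxᴹ (c ∷ cs) = just (argmax f c cs)

  argmaxᴹ-∈ : ∀ cs {c} → argmaxᴹ cs ≡ just c → c ∈ cs
  argmaxᴹ-∈ (c ∷ cs) refl with argmax-sel f c cs
  ... | inj₁ argmax≡c = subst (_∈ c ∷ cs) (sym argmax≡c) (here refl)
  ... | inj₂ argmax∈cs = there argmax∈cs

  argmaxᴹ-maximal : ∀ {cs c} → c ∈ cs → ∃[ c* ] argmaxᴹ cs ≡ just c* × f c ≤ f c*
  argmaxᴹ-maximal {c₀ ∷ cs} (here refl) = _ , refl , f[⊥]≤f[argmax] {f = f} c₀ cs
  argmaxᴹ-maximal {c₀ ∷ cs} (there c∈cs) = _ , refl , All.lookup (f[xs]≤f[argmax] {f = f} c₀ cs) c∈cs

module BestPaths {a n b : ℕ} (G : LayeredGraph a n) (C : Code G b) (ε : ℚ) (w : Vec (Fin b) n) where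

  open import Data.Bool using (true)
  open import Data.Fin as Fin using (Fin)
  open import Data.List as List using (List; []; [_]; concatMap; allFin; cartesianProduct)
  open import Data.List.Membership.Propositional using (_∈_)
  open import Data.List.Membership.Propositional.Properties
    using (∈-concatMap⁺; ∈-concatMap⁻; ∈-cartesianProduct⁺; ∈-allFin; ∈-++⁻; ∈-++⁺ʳ)
  open import Data.List.Relation.Unary.Any as Any using (here)
  open import Data.Maybe as Maybe using (Maybe; just)
  import Data.Maybe.Properties as Maybe
  open import Data.Nat as ℕ using (ℕ; zero; suc)
  import Data.Nat.Properties as ℕ
  open import Data.Product using (∃-syntax; _×_; _,_; proj₁)
  open import Data.Product.Properties using (,-injectiveˡ; ,-injectiveʳ-UIP)
  open import Data.Rational as ℚ using (ℚ; 0ℚ; 1ℚ; _+_; _-_; _≤_)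
  open import Data.Rational.Properties using (module ≤-Reasoning; ≤-refl; <-≤-trans; +-monoˡ-≤; ⊓-monoʳ-≤)
  open import Data.Sum using (inj₁; inj₂)
  open import Data.Vec using (Vec; []; _∷ʳ_)
  import Data.Vec.Properties as Vec
  open import Function using (Equivalence)
  open import Relation.Nullary using (yes; no; contradiction)
  open import Relation.Binary.PropositionalEquality hiding ([_])
  open AgreementStrings
  open LayeredPaths
  open MaybeArgmax
  open CodeAgreement G C ε
  open Slack (1ℚ - ε)

  private
    variable
      k : ℕ

  value : Vec (Fin a) k → ℚ
  value q = slack (agreements w q)

  potentialOf : Vec (Fin a) (suc k) → ℚ
  potentialOf q = potential (agreements w q)

  potentialOf-∷ʳ : ∀ (q : Vec (Fin a) k) σ {x} → vertexOf G q ≡ (k , x) →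
                   potentialOf (q ∷ʳ σ) ≡ value q + gain (agrees w (k , x , σ))
  potentialOf-∷ʳ q σ end = trans (cong potential (agreementsFrom-∷ʳ w 0 (root G) q σ end))
                                 (potential-∷ʳ (agreements w q) (agrees w (_ , _ , σ)))

  Extension : ℕ → Set
  Extension k = Fin (size G k) × Fin a × Vec (Fin a) k

  extended : Extension k → Vec (Fin a) (suc k)
  extended (_ , σ , q) = q ∷ʳ σ

  module _ (bestₖ : Fin (size G k) → Maybe (Vec (Fin a) k)) (y : Fin (size G (suc k))) where

    extensionsVia : Fin (size G k) × Fin a → List (Extension k)
    extensionsVia (x , σ) with step G k x σ Fin.≟ y | bestₖ x
    ... | yes _ | just q = [ (x , σ , q) ]
    ... | _     | _      = []

    extensions : List (Extension k)
    extensions = concatMap extensionsVia (cartesianProduct (allFin (size G k)) (allFin a))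

    ∈-extensions⁺ : ∀ {x σ q} → step G k x σ ≡ y → bestₖ x ≡ just q → (x , σ , q) ∈ extensions
    ∈-extensions⁺ {x} {σ} step≡ best≡ =
      ∈-concatMap⁺ extensionsVia
        (Any.map (λ { refl → via step≡ best≡ }) (∈-cartesianProduct⁺ (∈-allFin x) (∈-allFin σ)))
      where
      via : ∀ {x σ q} → step G k x σ ≡ y → bestₖ x ≡ just q → (x , σ , q) ∈ extensionsVia (x , σ)
      via {x} {σ} step≡ best≡ with step G k x σ Fin.≟ y | bestₖ x
      via step≡ refl | yes _ | just _ = here refl
      via step≡ _ | no step≢ | _ = contradiction step≡ step≢

    ∈-extensions⁻ : ∀ {x σ q} → (x , σ , q) ∈ extensions → step G k x σ ≡ y × bestₖ x ≡ just q
    ∈-extensions⁻ c∈ =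
      let xσ , c∈via = Any.satisfied
                         (∈-concatMap⁻ extensionsVia {xs = cartesianProduct (allFin (size G k)) (allFin a)} c∈)
      in via⁻ xσ c∈via
      where
      via⁻ : ∀ xσ {x σ q} → (x , σ , q) ∈ extensionsVia xσ → step G k x σ ≡ y × bestₖ x ≡ just q
      via⁻ (x , σ) c∈ with step G k x σ Fin.≟ y | bestₖ x in best≡
      via⁻ (x , σ) (here refl) | yes step≡ | just q = step≡ , best≡

  bestExtension : (Fin (size G k) → Maybe (Vec (Fin a) k)) → Fin (size G (suc k)) → Maybe (Extension k)
  bestExtension bestₖ y = argmaxᴹ (λ c → potentialOf (extended c)) (extensions bestₖ y)

  -- opaque, so that conversion checking never unfolds the dynamic programme
  opaque
    best : (k : ℕ) → Fin (size G k) → Maybe (Vec (Fin a) k)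
    best zero _ = just []
    best (suc k) y = Maybe.map extended (bestExtension (best k) y)

    best-zero : ∀ y → best zero y ≡ just []
    best-zero y = refl

    best-suc : ∀ k y → best (suc k) y ≡ Maybe.map extended (bestExtension (best k) y)
    best-suc k y = refl

  best-suc⁻ : ∀ k y {s} → best (suc k) y ≡ just s →
    ∃[ x ] ∃[ σ ] ∃[ q ] s ≡ q ∷ʳ σ × step G k x σ ≡ y × best k x ≡ just q
  best-suc⁻ k y best≡ with bestExtension (best k) y in choice≡ | trans (sym (best-suc k y)) best≡
  ... | just (x , σ , q) | refl =
    let step≡ , bestₖ≡ = ∈-extensions⁻ (best k) y (argmaxᴹ-∈ _ (extensions (best k) y) choice≡) in
    x , σ , q , refl , step≡ , bestₖ≡

  best-vertex : ∀ k y {q} → best k y ≡ just q → vertexOf G q ≡ (k , y)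
  best-vertex zero y {[]} _ = cong (0 ,_) (layer0-singleton G (root G) y)
  best-vertex (suc k) y best≡ with best-suc⁻ k y best≡
  ... | x , σ , q , refl , step≡ , bestₖ≡ =
    trans (walk-∷ʳ G 0 (root G) q σ (best-vertex k x bestₖ≡)) (cong (suc k ,_) step≡)

  mutual
    best-optimal : ∀ k y (q : Vec (Fin a) k) → vertexOf G q ≡ (k , y) →
                   ∃[ q* ] best k y ≡ just q* × value q ≤ value q*
    best-optimal zero y [] _ = [] , best-zero y , ≤-refl
    best-optimal (suc k) y q end =
      let q* , best≡ , pot≤pot* = best-potential k y q end in
      q* , best≡ ,
      subst₂ _≤_ (sym (slack≡0⊓potential (agreements w q))) (sym (slack≡0⊓potential (agreements w q*)))
        (⊓-monoʳ-≤ 0ℚ pot≤pot*)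

    best-potential : ∀ k y (q : Vec (Fin a) (suc k)) → vertexOf G q ≡ (suc k , y) →
                     ∃[ q* ] best (suc k) y ≡ just q* × potentialOf q ≤ potentialOf q*
    best-potential k y q end with vertexOf-∷ʳ⁻ G q end
    ... | q₀ , σ , x , refl , end₀ , step≡ with best-optimal k x q₀ end₀
    ...   | q₀* , bestₖ≡ , v≤v* with argmaxᴹ-maximal (λ c → potentialOf (extended c))
                                      (∈-extensions⁺ (best k) y step≡ bestₖ≡)
    ...     | c , choice≡ , pot≤pot* = extended c , trans (best-suc k y) (cong (Maybe.map extended) choice≡) , (begin
      potentialOf (q₀ ∷ʳ σ)                        ≡⟨ potentialOf-∷ʳ q₀ σ end₀ ⟩
      value q₀ + gain (agrees w (k , x , σ))       ≤⟨ +-monoˡ-≤ _ v≤v* ⟩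
      value q₀* + gain (agrees w (k , x , σ))      ≡⟨ potentialOf-∷ʳ q₀* σ (best-vertex k x bestₖ≡) ⟨
      potentialOf (q₀* ∷ʳ σ)                       ≤⟨ pot≤pot* ⟩
      potentialOf (extended c)                     ∎)
      where open ≤-Reasoning

  best-good : ∀ k y (q : Vec (Fin a) (suc k)) → vertexOf G q ≡ (suc k , y) → SuffixGood (agreements w q) →
              ∃[ q* ] best (suc k) y ≡ just q* × SuffixGood (agreements w q*)
  best-good k y q end good =
    let q* , best≡ , pot≤pot* = best-potential k y q end in
    q* , best≡ , Equivalence.from (SuffixGood⇔0<potential (agreements w q*))
                   (<-≤-trans (Equivalence.to (SuffixGood⇔0<potential (agreements w q)) good) pot≤pot*)

  BestLastEdge : Edge G → Set
  BestLastEdge (j , u , σ) = ∃[ q ] best (suc j) (step G j u σ) ≡ just (q ∷ʳ σ) × vertexOf G q ≡ (j , u)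

  best-edges : ∀ k y {q} → best k y ≡ just q → ∀ {e} → e ∈ pathEdges G q → BestLastEdge e
  best-edges zero y {[]} _ ()
  best-edges (suc k) y best≡ e∈ with best-suc⁻ k y best≡
  ... | x , σ , q , refl , step≡ , bestₖ≡
      rewrite edgesFrom-∷ʳ G 0 (root G) q σ (best-vertex k x bestₖ≡) with ∈-++⁻ (pathEdges G q) e∈
  ...   | inj₁ e∈q = best-edges k x bestₖ≡ e∈q
  ...   | inj₂ (here refl) =
    q , subst (λ z → best (suc k) z ≡ just (q ∷ʳ σ)) (sym step≡) best≡ , best-vertex k x bestₖ≡

  BestLastEdge-head-injective : ∀ {e e'} → BestLastEdge e → BestLastEdge e' → head G e ≡ head G e' → e ≡ e'
  BestLastEdge-head-injective {j , u , σ} {j' , u' , σ'} (q , best≡ , end) (q' , best'≡ , end') heads≡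
    with ℕ.suc-injective (,-injectiveˡ heads≡)
  ... | refl with ,-injectiveʳ-UIP ℕ.≡-irrelevant heads≡
  ...   | steps≡
    with Vec.∷ʳ-injective q q' (Maybe.just-injective (trans (sym best≡) (trans (cong (best (suc j)) steps≡) best'≡)))
  ...     | refl , refl with ,-injectiveʳ-UIP ℕ.≡-irrelevant (trans (sym end) end')
  ...       | refl = refl

  best-last-agrees : 1ℚ - ε ≤ 1ℚ → ∀ k y {s} → best (suc k) y ≡ just s → SuffixGood (agreements w s) →
    ∃[ e ] e ∈ pathEdges G s × agrees w e ≡ true × proj₁ e ≡ k × head G e ≡ (suc k , y)
  best-last-agrees d≤1 k y best≡ good with best-suc⁻ k y best≡
  ... | x , σ , q , refl , step≡ , bestₖ≡ =
    (k , x , σ) ,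
    subst ((k , x , σ) ∈_) (sym (edgesFrom-∷ʳ G 0 (root G) q σ end)) (∈-++⁺ʳ (pathEdges G q) (here refl)) ,
    SuffixGood-∷ʳ⇒agree d≤1 (agreements w q) (agrees w (k , x , σ))
      (subst SuffixGood (agreementsFrom-∷ʳ w 0 (root G) q σ end) good) ,
    refl , cong (suc k ,_) step≡
    where
    end : vertexOf G q ≡ (k , x)
    end = best-vertex k x bestₖ≡

module VecLemmas where

  open import Data.Fin.Properties using (any?)
  open import Data.Maybe as Maybe using (just)
  open import Data.Nat using (ℕ; zero; suc; s≤s; _<_)
  open import Data.Product using (∃; ∃-syntax; _,_)
  open import Data.Vec using (Vec; []; _∷_)
  open import Relation.Nullary using (Dec)
  import Relation.Nullary.Decidable as Dec
  open import Relation.Binary.PropositionalEquality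

  any-Vec? : ∀ {a} k {P : Vec (Fin a) k → Set} → (∀ p → Dec (P p)) → Dec (∃ P)
  any-Vec? zero P? = Dec.map′ ([] ,_) (λ { ([] , P[]) → P[] }) (P? [])
  any-Vec? (suc k) P? = Dec.map′ (λ { (x , xs , Pxxs) → x ∷ xs , Pxxs }) (λ { (x ∷ xs , Pxxs) → x , xs , Pxxs })
    (any? λ x → any-Vec? k (λ xs → P? (x ∷ xs)))

  mapWithPos : ∀ {A : Set} {m} → (ℕ → A → A) → Vec A m → Vec A m
  mapWithPos f [] = []
  mapWithPos f (x ∷ xs) = f 0 x ∷ mapWithPos (λ j → f (suc j)) xs

  wAt-mapWithPos : ∀ {A : Set} {m} f (xs : Vec A m) j → wAt (mapWithPos f xs) j ≡ Maybe.map (f j) (wAt xs j)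
  wAt-mapWithPos f [] j = refl
  wAt-mapWithPos f (x ∷ xs) zero = refl
  wAt-mapWithPos f (x ∷ xs) (suc j) = wAt-mapWithPos (λ j → f (suc j)) xs j

  wAt-< : ∀ {A : Set} {m} (xs : Vec A m) j → j < m → ∃[ c ] wAt xs j ≡ just c
  wAt-< (x ∷ xs) zero _ = x , refl
  wAt-< (x ∷ xs) (suc j) (s≤s j<m) = wAt-< xs j j<m

module ListCounting where

  open import Data.Bool using (Bool; true; false; if_then_else_)
  open import Data.Empty using (⊥-elim)
  open import Data.Fin.Subset using (∣_∣)
  open import Data.List as List using (List; []; _∷_; length; concat)
  import Data.List.Properties as List
  open import Data.List.Membership.Propositional using (_∈_)
  open import Data.List.Membership.Propositional.Properties using (∈-∃++; ∈-++⁻; ∈-++⁺ˡ; ∈-++⁺ʳ)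
  import Data.List.Relation.Unary.All as All
  open import Data.List.Relation.Unary.Any using (here; there)
  open import Data.List.Relation.Unary.AllPairs using (_∷_)
  open import Data.List.Relation.Unary.Unique.Propositional using (Unique)
  open import Data.Nat as ℕ using (zero; suc; z≤n; s≤s; _≤_)
  import Data.Nat.Properties as ℕ
  open import Data.Product using (_,_)
  open import Data.Sum using (inj₁; inj₂)
  import Data.Vec as Vec
  open import Relation.Binary.PropositionalEquality

  Unique-⊆⇒length≤ : ∀ {A : Set} {xs ys : List A} → Unique xs → (∀ {x} → x ∈ xs → x ∈ ys) →
                     length xs ≤ length ys
  Unique-⊆⇒length≤ {xs = []} _ _ = z≤n
  Unique-⊆⇒length≤ {xs = x ∷ xs} {ys} (x∉xs ∷ unique) xs⊆ys with ∈-∃++ (xs⊆ys (here refl))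
  ... | ys₁ , ys₂ , refl = begin
    suc (length xs)                    ≤⟨ s≤s (Unique-⊆⇒length≤ unique xs⊆ys₁++ys₂) ⟩
    suc (length (ys₁ List.++ ys₂))     ≡⟨ cong suc (List.length-++ ys₁) ⟩
    suc (length ys₁ ℕ.+ length ys₂)    ≡⟨ ℕ.+-suc (length ys₁) (length ys₂) ⟨
    length ys₁ ℕ.+ suc (length ys₂)    ≡⟨ List.length-++ ys₁ ⟨
    length (ys₁ List.++ x ∷ ys₂)       ∎
    where
    open ℕ.≤-Reasoning
    xs⊆ys₁++ys₂ : ∀ {z} → z ∈ xs → z ∈ ys₁ List.++ ys₂
    xs⊆ys₁++ys₂ z∈xs with ∈-++⁻ ys₁ (xs⊆ys (there z∈xs))
    ... | inj₁ z∈ys₁ = ∈-++⁺ˡ z∈ys₁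
    ... | inj₂ (here refl) = ⊥-elim (All.lookup x∉xs z∈xs refl)
    ... | inj₂ (there z∈ys₂) = ∈-++⁺ʳ ys₁ z∈ys₂

  ∣tabulate∣+length-concat : ∀ {A : Set} {m} (g : Fin m → Bool) (blocks : Fin m → List A) →
    (∀ j → length (blocks j) ≡ (if g j then 1 else 2)) →
    ∣ Vec.tabulate g ∣ ℕ.+ length (concat (List.tabulate blocks)) ≡ m ℕ.+ m
  ∣tabulate∣+length-concat {m = zero} g blocks _ = refl
  ∣tabulate∣+length-concat {A} {suc m} g blocks lengths
    with g Fin.zero | lengths Fin.zero
       | ∣tabulate∣+length-concat (λ j → g (Fin.suc j)) (λ j → blocks (Fin.suc j)) (λ j → lengths (Fin.suc j))
  ... | true | length≡1 | ih = begin
    suc (T ℕ.+ length (blocks Fin.zero List.++ R))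
      ≡⟨ cong (λ l → suc (T ℕ.+ l)) (trans (List.length-++ (blocks Fin.zero)) (cong (ℕ._+ length R) length≡1)) ⟩
    suc (T ℕ.+ suc (length R))                      ≡⟨ cong suc (ℕ.+-suc T (length R)) ⟩
    suc (suc (T ℕ.+ length R))                      ≡⟨ cong (λ l → suc (suc l)) ih ⟩
    suc (suc (m ℕ.+ m))                             ≡⟨ cong suc (ℕ.+-suc m m) ⟨
    suc m ℕ.+ suc m                                 ∎
    where
    open ≡-Reasoning
    T : ℕ
    T = ∣ Vec.tabulate (λ j → g (Fin.suc j)) ∣
    R : List A
    R = concat (List.tabulate (λ j → blocks (Fin.suc j)))
  ... | false | length≡2 | ih = begin
    T ℕ.+ length (blocks Fin.zero List.++ R)
      ≡⟨ cong (T ℕ.+_) (trans (List.length-++ (blocks Fin.zero)) (cong (ℕ._+ length R) length≡2)) ⟩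
    T ℕ.+ suc (suc (length R))                ≡⟨ trans (ℕ.+-suc T _) (cong suc (ℕ.+-suc T (length R))) ⟩
    suc (suc (T ℕ.+ length R))                ≡⟨ cong (λ l → suc (suc l)) ih ⟩
    suc (suc (m ℕ.+ m))                       ≡⟨ cong suc (ℕ.+-suc m m) ⟨
    suc m ℕ.+ suc m                           ∎
    where
    open ≡-Reasoning
    T : ℕ
    T = ∣ Vec.tabulate (λ j → g (Fin.suc j)) ∣
    R : List A
    R = concat (List.tabulate (λ j → blocks (Fin.suc j)))

module LayerCensus {a n b : ℕ} (G : LayeredGraph a n) (C : Code G b) (ε : ℚ) (w : Vec (Fin b) n) where

  open import Data.Bool.Properties using (T-≡)
  open import Data.Fin as Fin using (toℕ)
  open import Data.Fin.Properties using (toℕ<n)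
  open import Data.Fin.Subset using (Subset) renaming (_∈_ to _∈ₛ_)
  open import Data.Nat as ℕ using (suc; _≤_)
  open import Data.Product using (∃-syntax; _×_; _,_)
  open import Data.Product.Properties using (≡-dec)
  open import Data.Rational using (1ℚ; _-_; _<_)
  open import Data.Rational.Properties using (_<?_)
  open import Data.Vec as Vec using (Vec)
  open import Data.Vec.Properties using (lookup∘tabulate; []=⇒lookup; lookup⇒[]=)
  open import Function using (Equivalence)
  open import Relation.Nullary using (Dec; ¬_; _×-dec_; ¬?; decidable-stable)
  import Relation.Nullary.Decidable as Dec
  open import Relation.Binary.PropositionalEquality
  open VecLemmas

  Good : ∀ {k} → k ≤ n → Vec (Fin a) k → Set
  Good le p = sfxDist (codeword G C p) (prefix le w) < 1ℚ - ε

  -- TwoInL j says |L_{j+1}| ≥ 2: layers are 0-based here, and edges of layer j end in layer j + 1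
  TwoInL : Fin n → Set
  TwoInL j = ∃[ p ] ∃[ p' ] Good (toℕ<n j) p × Good (toℕ<n j) p' × ¬ vertexOf G p ≡ vertexOf G p'

  opaque
    twoInL? : ∀ j → Dec (TwoInL j)
    twoInL? j = any-Vec? (suc (toℕ j)) λ p → any-Vec? (suc (toℕ j)) λ p' →
      (_ <? _) ×-dec (_ <? _) ×-dec ¬? (≡-dec ℕ._≟_ Fin._≟_ (vertexOf G p) (vertexOf G p'))

  AtMostOneLayers : Subset n
  AtMostOneLayers = Vec.tabulate (λ j → Dec.isNo (twoInL? j))

  ¬TwoInL⇒AtMostOneL : ∀ j → ¬ TwoInL j → AtMostOneL G C w ε (suc (toℕ j)) (toℕ<n j)
  ¬TwoInL⇒AtMostOneL j not-two v v' (p , good , p↦v) (p' , good' , p'↦v') =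
    trans (sym p↦v) (trans same-vertex p'↦v')
    where
    same-vertex : vertexOf G p ≡ vertexOf G p'
    same-vertex = decidable-stable (≡-dec ℕ._≟_ Fin._≟_ (vertexOf G p) (vertexOf G p'))
                    (λ different → not-two (p , p' , good , good' , different))

  ∈AtMostOneLayers⇒¬TwoInL : ∀ {j} → j ∈ₛ AtMostOneLayers → ¬ TwoInL j
  ∈AtMostOneLayers⇒¬TwoInL {j} j∈ =
    Dec.toWitnessFalse (Equivalence.from T-≡ (trans (sym (lookup∘tabulate _ j)) ([]=⇒lookup j∈)))

  ¬TwoInL⇒∈AtMostOneLayers : ∀ {j} → ¬ TwoInL j → j ∈ₛ AtMostOneLayers
  ¬TwoInL⇒∈AtMostOneLayers {j} not-two =
    lookup⇒[]= j AtMostOneLayers (trans (lookup∘tabulate _ j) (Equivalence.to T-≡ (Dec.fromWitnessFalse not-two)))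

module PrefixTree {a n b : ℕ} (G : LayeredGraph a n) (C : Code G b) (ε : ℚ) (w : Vec (Fin b) n)
                  (0<d : 0ℚ ℚ.< 1ℚ - ε) (d≤1 : 1ℚ - ε ℚ.≤ 1ℚ) where

  open import Data.Bool as Bool using (Bool; true; if_then_else_)
  open import Data.Empty using (⊥-elim)
  open import Data.Fin as Fin using (toℕ)
  open import Data.Fin.Properties as Fin using (toℕ<n)
  open import Data.Fin.Subset using (∣_∣)
  open import Data.List as List using (List; []; _∷_; [_]; concatMap; allFin; length)
  import Data.List.Properties as List
  open import Data.List.Extrema.Nat using (argmax; f[xs]≤f[argmax])
  open import Data.List.Membership.Propositional using (_∈_; find)
  open import Data.List.Membership.Propositional.Properties
    using (∈-concatMap⁺; ∈-concatMap⁻; ∈-concat⁻; ∈-++⁻; ∈-++⁺ˡ; ∈-++⁺ʳ; ∈-filter⁺; ∈-deduplicate⁺)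
  import Data.List.Relation.Unary.All as All
  import Data.List.Relation.Unary.All.Properties as All
  import Data.List.Relation.Unary.AllPairs as AllPairs
  import Data.List.Relation.Unary.AllPairs.Properties as AllPairs
  open import Data.List.Relation.Unary.Any as Any using (Any; here; there; any?)
  import Data.List.Relation.Unary.Any.Properties as Any
  open import Data.List.Relation.Unary.Unique.Propositional using (Unique)
  import Data.List.Relation.Unary.Unique.Propositional.Properties as Unique
  open import Data.Maybe as Maybe using (Maybe; just; nothing)
  open import Data.Nat as ℕ using (ℕ; suc; z≤n; s≤s; _≤_; _<_)
  import Data.Nat.Properties as ℕ
  open import Data.Product using (Σ-syntax; ∃-syntax; _×_; _,_; proj₁; proj₂)
  open import Data.Rational as ℚ using (0ℚ; 1ℚ; _-_)
  open import Data.Rational.Properties using (_<?_; ≤-trans)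
  open import Data.Sum as Sum using (_⊎_; inj₁; inj₂)
  open import Data.Vec as Vec using (Vec; []; _∷_; _++_)
  open import Data.Vec.Relation.Binary.Pointwise.Inductive using (Pointwise; []; _∷_)
  open import Function using (_⇔_; Equivalence)
  open import Relation.Nullary using (Dec; yes; no; ¬_; _×-dec_)
  open import Relation.Nullary.Decidable using (isNo)
  open import Relation.Binary.PropositionalEquality hiding ([_])
  open RationalLemmas
  open AgreementStrings
  open LayeredPaths
  open VecLemmas
  open ListCounting
  open CodeAgreement G C ε
  open Slack (1ℚ - ε)
  open BestPaths G C ε w
  open LayerCensus G C ε w

  good⇔SuffixGood : ∀ ω {k} (le : k ≤ n) (q : Vec (Fin a) k) →
                    sfxDist (codeword G C q) (prefix le ω) ℚ.< 1ℚ - ε ⇔ SuffixGood (agreements ω q)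
  good⇔SuffixGood ω le q =
    subst (λ δ → δ ℚ.< 1ℚ - ε ⇔ _) (sym (sfxDist-codeword ω le q)) (sfxDistᵇ<d⇔SuffixGood 0<d (agreements ω q))

  record Member : Set where
    constructor member
    field
      depth : Fin n
      {vertex} : Fin (size G (suc (toℕ depth)))
      {path} : Vec (Fin a) (suc (toℕ depth))
      best≡ : best (suc (toℕ depth)) vertex ≡ just path
      good : SuffixGood (agreements w path)
  open Member

  membersVia : (j : Fin n) (y : Fin (size G (suc (toℕ j)))) (m : Maybe (Vec (Fin a) (suc (toℕ j)))) →
               best (suc (toℕ j)) y ≡ m → List Member
  membersVia j y nothing _ = []
  membersVia j y (just s) best≡ with sfxDistᵇ (agreements w s) <? 1ℚ - ε
  ... | yes lt = [ member j best≡ (Equivalence.to (sfxDistᵇ<d⇔SuffixGood 0<d _) lt) ]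
  ... | no _ = []

  membersAt : (j : Fin n) → Fin (size G (suc (toℕ j))) → List Member
  membersAt j y = membersVia j y (best (suc (toℕ j)) y) refl

  members : List Member
  members = concatMap (λ j → concatMap (membersAt j) (allFin _)) (allFin n)

  membersVia-complete : ∀ j y m (best≡ : best (suc (toℕ j)) y ≡ m) {s} → m ≡ just s → SuffixGood (agreements w s) →
                        Any (λ t → pathEdges G (path t) ≡ pathEdges G s) (membersVia j y m best≡)
  membersVia-complete j y (just s) best≡ refl good with sfxDistᵇ (agreements w s) <? 1ℚ - ε
  ... | yes _ = here refl
  ... | no ¬lt = ⊥-elim (¬lt (Equivalence.from (sfxDistᵇ<d⇔SuffixGood 0<d _) good))

  members-complete : ∀ t → Any (λ t' → pathEdges G (path t') ≡ pathEdges G (path t)) members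
  members-complete (member j {y} best≡ good) =
    Any.concatMap⁺ (λ j → concatMap (membersAt j) (allFin _))
      (Any.tabulate⁺ j (Any.concatMap⁺ (membersAt j) (Any.tabulate⁺ y (membersVia-complete j y _ refl best≡ good))))

  treeEdges : List (Edge G)
  treeEdges = concatMap (λ t → pathEdges G (path t)) members

  member-edges⊆treeEdges : ∀ t {e} → e ∈ pathEdges G (path t) → e ∈ treeEdges
  member-edges⊆treeEdges t e∈ =
    ∈-concatMap⁺ (λ t → pathEdges G (path t)) (Any.map (λ same → subst (_ ∈_) (sym same) e∈) (members-complete t))

  goodMember : ∀ j (p : Vec (Fin a) (suc (toℕ j))) → Good (toℕ<n j) p → Member
  goodMember j p good-p =
    let y , p-end = walk-layer G 0 (root G) p
        s , best≡ , good-s = best-good (toℕ j) y p p-end (Equivalence.to (good⇔SuffixGood w (toℕ<n j) p) good-p)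
    in member j best≡ good-s

  goodMember-vertex : ∀ j p good-p → vertexOf G p ≡ (suc (toℕ j) , vertex (goodMember j p good-p))
  goodMember-vertex j p good-p = proj₂ (walk-layer G 0 (root G) p)

  module Spine (t₀ : Member) where

    deepest : Member
    deepest = argmax (λ t → toℕ (depth t)) t₀ members

    M : ℕ
    M = toℕ (depth deepest)

    treeEdges-layer : ∀ {e} → e ∈ treeEdges → proj₁ e < suc M
    treeEdges-layer e∈ with find (∈-concatMap⁻ (λ t → pathEdges G (path t)) e∈)
    ... | t , t∈ , e∈t = ℕ.<-≤-trans (proj₂ (∈edgesFrom⇒layer G 0 (root G) (path t) e∈t))
                           (s≤s (All.lookup (f[xs]≤f[argmax] t₀ members) t∈))

    filler : Vec (Fin a) (n ℕ.∸ suc M)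
    filler = Vec.replicate _ (Vec.head (path deepest))

    spine : Vec (Fin a) (suc M ℕ.+ (n ℕ.∸ suc M))
    spine = path deepest ++ filler

    spine-length : suc M ℕ.+ (n ℕ.∸ suc M) ≡ n
    spine-length = ℕ.m+[n∸m]≡n (toℕ<n (depth deepest))

    deepest-end : vertexOf G (path deepest) ≡ (suc M , vertex deepest)
    deepest-end = best-vertex (suc M) (vertex deepest) (best≡ deepest)

    spine-edges : pathEdges G spine ≡ pathEdges G (path deepest) List.++ edgesFrom G (suc M) (vertex deepest) filler
    spine-edges = edgesFrom-++ G 0 (root G) (path deepest) filler deepest-end

    AgreesAt : ℕ → Set
    AgreesAt j = Any (λ e → proj₁ e ≡ j × agrees w e ≡ true) treeEdges

    AgreesAt? : ∀ j → Dec (AgreesAt j)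
    AgreesAt? j = any? (λ e → (proj₁ e ℕ.≟ j) ×-dec (agrees w e Bool.≟ true)) treeEdges

    label : Edge G → Fin b
    label (j , u , σ) = C j u σ

    relabel : ℕ → Fin b → Fin b
    relabel j c with AgreesAt? j | any? (λ e → proj₁ e ℕ.≟ j) (pathEdges G spine)
    ... | yes _ | _ = c
    ... | no _ | yes at-j = label (proj₁ (find at-j))
    ... | no _ | no _ = c

    w' : Vec (Fin b) n
    w' = mapWithPos relabel w

    relabel-agreeing : ∀ {j} c → AgreesAt j → relabel j c ≡ c
    relabel-agreeing {j} c agrees-at-j with AgreesAt? j
    ... | yes _ = refl
    ... | no ¬agrees-at-j = ⊥-elim (¬agrees-at-j agrees-at-j)

    relabel-spine : ∀ {j} c {e} → ¬ AgreesAt j → e ∈ pathEdges G spine → proj₁ e ≡ j → relabel j c ≡ label e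
    relabel-spine {j} c {e} ¬agrees-at-j e∈spine e-at-j
      with AgreesAt? j | any? (λ e → proj₁ e ℕ.≟ j) (pathEdges G spine)
    ... | yes agrees-at-j | _ = ⊥-elim (¬agrees-at-j agrees-at-j)
    ... | no _ | no ¬at-j = ⊥-elim (¬at-j (Any.map (λ { refl → e-at-j }) e∈spine))
    ... | no _ | yes at-j =
      let e' , e'∈spine , e'-at-j = find at-j in
      cong label (edgesFrom-layer-injective G 0 (root G) spine e'∈spine e∈spine (trans e'-at-j (sym e-at-j)))

    wAt-w' : ∀ j → wAt w' j ≡ Maybe.map (relabel j) (wAt w j)
    wAt-w' = wAt-mapWithPos relabel w

    agrees-w' : ∀ {e} → e ∈ treeEdges → agrees w e ≡ true → agrees w' e ≡ true
    agrees-w' {j , u , σ} e∈ agree = Equivalence.from (agrees≡true⇔ w' j u σ) (begin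
      wAt w' j                        ≡⟨ wAt-w' j ⟩
      Maybe.map (relabel j) (wAt w j) ≡⟨ cong (Maybe.map (relabel j)) (Equivalence.to (agrees≡true⇔ w j u σ) agree) ⟩
      just (relabel j (C j u σ))
        ≡⟨ cong just (relabel-agreeing (C j u σ) (Any.map (λ { refl → refl , agree }) e∈)) ⟩
      just (C j u σ)                  ∎)
      where open ≡-Reasoning

    agrees-w'-spine : ∀ {e} → e ∈ pathEdges G spine → ¬ AgreesAt (proj₁ e) → agrees w' e ≡ true
    agrees-w'-spine {j , u , σ} e∈spine ¬agrees-at-j =
      let c , w[j] = wAt-< w j (subst (j <_) spine-length (proj₂ (∈edgesFrom⇒layer G 0 (root G) spine e∈spine))) in
      Equivalence.from (agrees≡true⇔ w' j u σ)
        (trans (wAt-w' j) (trans (cong (Maybe.map (relabel j)) w[j]) (cong just (relabel-spine c ¬agrees-at-j e∈spine refl))))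

    agreements-w'-dominate : ∀ {k} i u (q : Vec (Fin a) k) → (∀ {e} → e ∈ edgesFrom G i u q → e ∈ treeEdges) →
                             Pointwise Bool._≤_ (agreementsFrom w i u q) (agreementsFrom w' i u q)
    agreements-w'-dominate i u [] _ = []
    agreements-w'-dominate i u (x ∷ q) ⊆tree =
      implies⇒≤ (agrees-w' (⊆tree (here refl))) ∷
      agreements-w'-dominate (suc i) (step G i u x) q (λ e∈ → ⊆tree (there e∈))

    member-good' : ∀ t → SuffixGood (agreements w' (path t))
    member-good' t = SuffixGood-antitone (agreements-w'-dominate 0 (root G) (path t) (member-edges⊆treeEdges t)) (good t)

    filler-agrees : ∀ {e} → e ∈ edgesFrom G (suc M) (vertex deepest) filler → agrees w' e ≡ true
    filler-agrees {e} e∈filler = agrees-w'-spine e∈spine ¬agrees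
      where
      e∈spine : e ∈ pathEdges G spine
      e∈spine = subst (e ∈_) (sym spine-edges) (∈-++⁺ʳ (pathEdges G (path deepest)) e∈filler)
      ¬agrees : ¬ AgreesAt (proj₁ e)
      ¬agrees agrees-at = let e' , e'∈ , e'-at , _ = find agrees-at in
        ℕ.<-irrefl refl (ℕ.<-≤-trans (subst (_< suc M) e'-at (treeEdges-layer e'∈))
                                     (proj₁ (∈edgesFrom⇒layer G (suc M) (vertex deepest) filler e∈filler)))

    spine-good' : SuffixGood (agreements w' spine)
    spine-good' = subst SuffixGood (sym (agreementsFrom-++ w' 0 (root G) (path deepest) filler deepest-end))
      (SuffixGood-++-agreeing 0<d (agreements w' (path deepest)) _
        (agreementsFrom-all-agree w' (suc M) (vertex deepest) filler filler-agrees) (member-good' deepest))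

    memberPath : Member → GoodPath G C w' ε
    memberPath t = record
      { len = suc (toℕ (depth t)) ; len-pos = s≤s z≤n ; len-le = toℕ<n (depth t) ; str = path t
      ; good = Equivalence.from (good⇔SuffixGood w' (toℕ<n (depth t)) (path t)) (member-good' t) }

    spinePath : GoodPath G C w' ε
    spinePath = record
      { len = suc M ℕ.+ (n ℕ.∸ suc M) ; len-pos = s≤s z≤n ; len-le = ℕ.≤-reflexive spine-length ; str = spine
      ; good = Equivalence.from (good⇔SuffixGood w' (ℕ.≤-reflexive spine-length) spine) spine-good' }

    paths : List (GoodPath G C w' ε)
    paths = List.map memberPath members List.++ [ spinePath ]

    union : List (Edge G)
    union = unionEdges G C w' ε paths

    union≡ : union ≡ treeEdges List.++ (pathEdges G spine List.++ [])
    union≡ = trans (List.concatMap-++ strEdges (List.map memberPath members) [ spinePath ])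
                   (cong (List._++ (pathEdges G spine List.++ [])) (List.concatMap-map strEdges memberPath members))
      where
      strEdges : GoodPath G C w' ε → List (Edge G)
      strEdges q = pathEdges G (GoodPath.str q)

    treeEdges⊆union : ∀ {e} → e ∈ treeEdges → e ∈ union
    treeEdges⊆union e∈ = subst (_ ∈_) (sym union≡) (∈-++⁺ˡ e∈)

    spine⊆union : ∀ {e} → e ∈ pathEdges G spine → e ∈ union
    spine⊆union e∈ = subst (_ ∈_) (sym union≡) (∈-++⁺ʳ treeEdges (∈-++⁺ˡ e∈))

    tree-edge : ∀ {e} → e ∈ treeEdges → BestLastEdge e × proj₁ e < suc M
    tree-edge e∈ = let t , _ , e∈t = find (∈-concatMap⁻ (λ t → pathEdges G (path t)) {xs = members} e∈) in
      best-edges _ (vertex t) (best≡ t) e∈t , treeEdges-layer e∈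

    UnionEdge : Edge G → Set
    UnionEdge e = (BestLastEdge e × proj₁ e < suc M) ⊎ (suc M ≤ proj₁ e × e ∈ pathEdges G spine)

    ∈union⁻ : ∀ {e} → e ∈ union → e ∈ treeEdges ⊎ e ∈ pathEdges G spine
    ∈union⁻ {e} e∈ = Sum.map₂ (subst (e ∈_) (List.++-identityʳ (pathEdges G spine)))
                              (∈-++⁻ treeEdges (subst (e ∈_) union≡ e∈))

    deepest-edge : ∀ {e} → e ∈ pathEdges G (path deepest) → BestLastEdge e × proj₁ e < suc M
    deepest-edge e∈ = best-edges (suc M) (vertex deepest) (best≡ deepest) e∈ ,
                      proj₂ (∈edgesFrom⇒layer G 0 (root G) (path deepest) e∈)

    filler-edge-layer : ∀ {e} → e ∈ edgesFrom G (suc M) (vertex deepest) filler → suc M ≤ proj₁ e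
    filler-edge-layer e∈ = proj₁ (∈edgesFrom⇒layer G (suc M) (vertex deepest) filler e∈)

    spine-edge : ∀ {e} → e ∈ pathEdges G spine → UnionEdge e
    spine-edge {e} e∈spine =
      Sum.[ (λ e∈deepest → inj₁ (deepest-edge e∈deepest))
          , (λ e∈filler → inj₂ (filler-edge-layer e∈filler , e∈spine)) ]′
        (∈-++⁻ (pathEdges G (path deepest)) (subst (e ∈_) spine-edges e∈spine))

    union-edge : ∀ {e} → e ∈ union → UnionEdge e
    union-edge e∈ = Sum.[ (λ e∈tree → inj₁ (tree-edge e∈tree)) , spine-edge ]′ (∈union⁻ e∈)

    isTree : IsTree G C w' ε paths
    isTree e e' e∈ e'∈ heads≡ = heads-injective (union-edge e∈) (union-edge e'∈)
      where
      same-layer : proj₁ e ≡ proj₁ e'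
      same-layer = ℕ.suc-injective (cong proj₁ heads≡)
      heads-injective : UnionEdge e → UnionEdge e' → e ≡ e'
      heads-injective (inj₁ (last , _)) (inj₁ (last' , _)) = BestLastEdge-head-injective last last' heads≡
      heads-injective (inj₂ (_ , e∈spine)) (inj₂ (_ , e'∈spine)) =
        edgesFrom-layer-injective G 0 (root G) spine e∈spine e'∈spine same-layer
      heads-injective (inj₁ (_ , shallow)) (inj₂ (deep , _)) =
        ⊥-elim (ℕ.<-irrefl refl (ℕ.<-≤-trans shallow (subst (suc M ≤_) (sym same-layer) deep)))
      heads-injective (inj₂ (deep , _)) (inj₁ (_ , shallow)) =
        ⊥-elim (ℕ.<-irrefl refl (ℕ.<-≤-trans shallow (subst (suc M ≤_) same-layer deep)))

    GoodEdgeAt : Fin n → Edge G → Set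
    GoodEdgeAt j e = e ∈ union × agrees w' e ≡ true × proj₁ e ≡ toℕ j

    goodEdgeAt : ∀ j → Dec (AgreesAt (toℕ j)) → ∃[ e ] GoodEdgeAt j e
    goodEdgeAt j (yes agrees-at) = let e , e∈ , e-at , agree = find agrees-at in
      e , treeEdges⊆union e∈ , agrees-w' e∈ agree , e-at
    goodEdgeAt j (no ¬agrees-at) =
      let e , e∈ , e-at = find (edgesFrom-layer-surjective G 0 (root G) spine (toℕ j) z≤n
                                  (subst (toℕ j <_) (sym spine-length) (toℕ<n j))) in
      e , spine⊆union e∈ , agrees-w'-spine e∈ (subst (λ l → ¬ AgreesAt l) (sym e-at) ¬agrees-at) , e-at

    goodEdgeInto : ∀ j (p : Vec (Fin a) (suc (toℕ j))) → Good (toℕ<n j) p →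
                   ∃[ e ] GoodEdgeAt j e × head G e ≡ vertexOf G p
    goodEdgeInto j p good-p =
      let t = goodMember j p good-p
          e , e∈t , agree , e-at , e-head = best-last-agrees d≤1 (toℕ j) (vertex t) (best≡ t) (good t)
          e∈tree = member-edges⊆treeEdges t e∈t
      in e , (treeEdges⊆union e∈tree , agrees-w' e∈tree agree , e-at) , trans e-head (sym (goodMember-vertex j p good-p))

    Block : Fin n → Bool → Set
    Block j atMostOne =
      Σ[ es ∈ List (Edge G) ] All.All (GoodEdgeAt j) es × Unique es × length es ≡ (if atMostOne then 1 else 2)

    blockFor : ∀ j (c : Dec (TwoInL j)) → Block j (isNo c)
    blockFor j (no _) =
      let e , good = goodEdgeAt j (AgreesAt? (toℕ j)) in
      [ e ] , good All.∷ All.[] , All.[] AllPairs.∷ AllPairs.[] , refl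
    blockFor j (yes (p , p' , good-p , good-p' , p≢p')) =
      let e , good , e↦p = goodEdgeInto j p good-p
          e' , good' , e'↦p' = goodEdgeInto j p' good-p' in
      e ∷ e' ∷ [] , good All.∷ good' All.∷ All.[] ,
      ((λ e≡e' → p≢p' (trans (sym e↦p) (trans (cong (head G) e≡e') e'↦p'))) All.∷ All.[])
        AllPairs.∷ All.[] AllPairs.∷ AllPairs.[] ,
      refl

    block : Fin n → List (Edge G)
    block j = proj₁ (blockFor j (twoInL? j))

    witnesses : List (Edge G)
    witnesses = List.concat (List.tabulate block)

    witnesses-unique : Unique witnesses
    witnesses-unique = Unique.concat⁺ (All.tabulate⁺ (λ j → proj₁ (proj₂ (proj₂ (blockFor j (twoInL? j))))))
      (AllPairs.tabulate⁺ λ {i} {j} i≢j (e∈i , e∈j) → i≢j (Fin.toℕ-injective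
        (trans (sym (layer i e∈i)) (layer j e∈j))))
      where
      layer : ∀ j {e} → e ∈ block j → proj₁ e ≡ toℕ j
      layer j e∈ = proj₂ (proj₂ (All.lookup (proj₁ (proj₂ (blockFor j (twoInL? j)))) e∈))

    witnesses⊆agreeing : ∀ {e} → e ∈ witnesses →
                         e ∈ List.filterᵇ (agreesB G C w' ε) (List.deduplicate (_≟E_ G) union)
    witnesses⊆agreeing e∈ =
      let j , e∈j = Any.tabulate⁻ (∈-concat⁻ (List.tabulate block) e∈)
          e∈union , agree , _ = All.lookup (proj₁ (proj₂ (blockFor j (twoInL? j)))) e∈j
      in ∈-filter⁺ (λ e → Bool.T? (agreesB G C w' ε e)) (∈-deduplicate⁺ (_≟E_ G) e∈union)
                   (subst Bool.T (sym agree) _)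

    ∣AtMostOneLayers∣+witnesses : ∣ AtMostOneLayers ∣ ℕ.+ length witnesses ≡ n ℕ.+ n
    ∣AtMostOneLayers∣+witnesses = ∣tabulate∣+length-concat (λ j → isNo (twoInL? j)) block
                               (λ j → proj₂ (proj₂ (proj₂ (blockFor j (twoInL? j)))))

    witnesses≤agr : length witnesses ≤ agr G C w' ε paths
    witnesses≤agr = Unique-⊆⇒length≤ witnesses-unique witnesses⊆agreeing

    sensitivity-bound : Sensitive G C ε → (1ℚ - ε) ℚ.* ℕtoℚ n ℚ.≤ ℕtoℚ ∣ AtMostOneLayers ∣
    sensitivity-bound sensitive =
      counting-bound ∣ AtMostOneLayers ∣ (length witnesses) n ε ∣AtMostOneLayers∣+witnesses
        (≤-trans (ℕtoℚ-mono-≤ witnesses≤agr) (sensitive w' paths isTree))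

open import Data.Nat using (suc)
open import Data.Fin using (toℕ)
open import Data.Fin.Properties using (toℕ<n; any?)
open import Data.Fin.Subset using (Subset; _∈_; ∣_∣; ⊤)
open import Data.Fin.Subset.Properties using (∣⊤∣≡n; p⊆q⇒∣p∣≤∣q∣)
open import Data.Product using (Σ-syntax; ∃; _×_; _,_)
open import Data.Rational using (_<_; _≤_; _*_)
open import Data.Rational.Properties using (_<?_; ≤-trans; ≮⇒≥; <⇒≤; +-identityʳ; +-monoʳ-≤; neg-antimono-≤)
open import Relation.Nullary using (Dec; yes; no)
open import Relation.Binary.PropositionalEquality
open RationalLemmas

lemma5p12 : (a b n : ℕ) (G : LayeredGraph a n) (ε : ℚ) → 0ℚ < ε →
    (C : Code G b) → Sensitive G C ε → (w : Vec (Fin b) n) →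
    Σ[ S ∈ Subset n ] ((1ℚ - ε) * ℕtoℚ n ≤ ℕtoℚ ∣ S ∣ ×
      (∀ (j : Fin n) → j ∈ S → AtMostOneL G C w ε (suc (toℕ j)) (toℕ<n j)))
lemma5p12 a b n G ε 0<ε C sensitive w =
  AtMostOneLayers , size-bound (0ℚ <? 1ℚ - ε) (any? twoInL?) ,
  λ j j∈ → ¬TwoInL⇒AtMostOneL j (∈AtMostOneLayers⇒¬TwoInL j∈)
  where
  open LayerCensus G C ε w

  d≤1 : 1ℚ - ε ≤ 1ℚ
  d≤1 = subst (1ℚ - ε ≤_) (+-identityʳ 1ℚ) (+-monoʳ-≤ 1ℚ (neg-antimono-≤ (<⇒≤ 0<ε)))

  size-bound : Dec (0ℚ < 1ℚ - ε) → Dec (∃ TwoInL) → (1ℚ - ε) * ℕtoℚ n ≤ ℕtoℚ ∣ AtMostOneLayers ∣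
  size-bound (no d≯0) _ = ≤-trans (*ℕtoℚ-≤-0 n (≮⇒≥ d≯0)) (ℕtoℚ-nonNeg ∣ AtMostOneLayers ∣)
  -- the spine of the prefix tree starts from some vertex of L, supplied here by a crowded layer
  size-bound (yes 0<d) (yes (j , p , _ , good-p , _)) =
    Spine.sensitivity-bound (goodMember j p good-p) sensitive
    where open PrefixTree G C ε w 0<d d≤1
  size-bound (yes _) (no ¬any-two) = ≤-trans (*ℕtoℚ-≤-ℕtoℚ n d≤1)
    (subst (λ m → ℕtoℚ m ≤ ℕtoℚ ∣ AtMostOneLayers ∣) (∣⊤∣≡n n)
      (ℕtoℚ-mono-≤ (p⊆q⇒∣p∣≤∣q∣ {p = ⊤} λ _ → ¬TwoInL⇒∈AtMostOneLayers (λ two → ¬any-two (_ , two)))))
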